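{- Let $m,n\ge1$ and $0\le k\le n$ be integers. For $\mathbf{x}\in(\mathbb{Z}_m)^n$ let $\mathcal{Z}(\mathbf{x})$ be the number of coordinates of $\mathbf{x}$ equal to $0$, and let $A$ be the $m^n\times m^n$ matrix with rows and columns indexed by $(\mathbb{Z}_m)^n$ and $(\mathbf{f},\mathbf{g})$-entry $\binom{\mathcal{Z}(\mathbf{g}-\mathbf{f})}{k}$. Then the spectrum of $A$ consists of: (i) the eigenvalue $0$, with multiplicity $\sum_{t<n-k}\binom{n}{t}(m-1)^{n-t}$; (ii) for each $t\in\{n-k,n-k+1,\dots,n\}$, the eigenvalue $m^{n-k}\binom{t}{n-k}$, with multiplicity $\binom{n}{t}(m-1)^{n-t}$. In particular, the kernel of $A$ has dimension $\sum_{t<n-k}\binom{n}{t}(m-1)^{n-t}$, and the rank of $A$ is $\sum_{s\le k}\binom{n}{s}(m-1)^s$.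
   Context: Sums over $t$ and $s$ range over non-negative integers. -}

module Defs where

open import Data.Nat as ℕ using (ℕ; zero; suc; _∸_; _^_)
open import Data.Nat.DivMod using (_mod_)
open import Data.Nat.Combinatorics using (_C_)
open import Data.Fin using (Fin; toℕ)
open import Data.Vec using (Vec; []; _∷_; zipWith)
open import Data.List using (List; []; _∷_; concatMap; map; upTo; allFin; foldr)
open import Data.Nat.ListAction using (sum)
open import Data.Bool using (if_then_else_)
open import Data.Product using (Σ; _×_; ∃)
open import Data.Integer using (+_)
open import Data.Rational using (ℚ; 0ℚ; _+_; _*_; _/_)
open import Data.Rational.Properties using (_≟_)
open import Relation.Nullary using (¬_)
open import Relation.Nullary.Decidable using (⌊_⌋)
open import Relation.Binary.PropositionalEquality using (_≡_)

ℕ→ℚ : ℕ → ℚ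
ℕ→ℚ a = (+ a) / 1

-- subtraction in ℤ_m (elements of ℤ_m are represented by Fin m)
subZ : ∀ {m} → Fin m → Fin m → Fin m
subZ {suc m'} a b = ((toℕ a ℕ.+ suc m') ∸ toℕ b) mod (suc m')

_⊖_ : ∀ {m n} → Vec (Fin m) n → Vec (Fin m) n → Vec (Fin m) n
g ⊖ f = zipWith subZ g f

𝒵 : ∀ {m n} → Vec (Fin m) n → ℕ
𝒵 [] = 0
𝒵 (a ∷ x) with toℕ a
... | zero  = suc (𝒵 x)
... | suc _ = 𝒵 x

A : ∀ {m n} (k : ℕ) → Vec (Fin m) n → Vec (Fin m) n → ℚ
A k f g = ℕ→ℚ (𝒵 (g ⊖ f) C k)

allVecs : (m n : ℕ) → List (Vec (Fin m) n)
allVecs m zero    = [] ∷ []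
allVecs m (suc n) = concatMap (λ a → map (a ∷_) (allVecs m n)) (allFin m)

QVec : ℕ → ℕ → Set
QVec m n = Vec (Fin m) n → ℚ

sumℚ : List ℚ → ℚ
sumℚ = foldr _+_ 0ℚ

Amul : (m n k : ℕ) → QVec m n → QVec m n
Amul m n k v f = sumℚ (map (λ g → A k f g * v g) (allVecs m n))

lincomb : ∀ {m n} (d : ℕ) → (Fin d → ℚ) → (Fin d → QVec m n) → QVec m n
lincomb d c vs x = sumℚ (map (λ i → c i * vs i x) (allFin d))

LinIndep : ∀ {m n} (d : ℕ) → (Fin d → QVec m n) → Set
LinIndep {m} {n} d vs =
  (c : Fin d → ℚ) → ((x : Vec (Fin m) n) → lincomb d c vs x ≡ 0ℚ) → (i : Fin d) → c i ≡ 0ℚ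

HasDim : (m n : ℕ) → (QVec m n → Set) → ℕ → Set
HasDim m n P d =
  (Σ (Fin d → QVec m n) λ vs → ((i : Fin d) → P (vs i)) × LinIndep d vs)
  × ((vs : Fin (suc d) → QVec m n) → ((i : Fin (suc d)) → P (vs i)) → ¬ LinIndep (suc d) vs)

Eigenspace : (m n k : ℕ) → ℚ → QVec m n → Set
Eigenspace m n k μ v = (f : Vec (Fin m) n) → Amul m n k v f ≡ μ * v f

Image : (m n k : ℕ) → QVec m n → Set
Image m n k v = ∃ λ w → (f : Vec (Fin m) n) → v f ≡ Amul m n k w f

ind : ℚ → ℚ → ℕ → ℕ
ind μ ν c = if ⌊ μ ≟ ν ⌋ then c else 0

term : (m n t : ℕ) → ℕ
term m n t = (n C t) ℕ.* ((m ∸ 1) ^ (n ∸ t))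

sum-kernel : (m n k : ℕ) → ℕ
sum-kernel m n k = sum (map (term m n) (upTo (n ∸ k)))

eigMult : (m n k : ℕ) → ℚ → ℕ
eigMult m n k μ =
  ind μ 0ℚ (sum-kernel m n k)
  ℕ.+ sum (map (λ j → let t = (n ∸ k) ℕ.+ j in
                 ind μ (ℕ→ℚ ((m ^ (n ∸ k)) ℕ.* (t C (n ∸ k)))) (term m n t))
               (upTo (suc k)))

rankFormula : (m n k : ℕ) → ℕ
rankFormula m n k = sum (map (λ s → (n C s) ℕ.* ((m ∸ 1) ^ s)) (upTo (suc k)))

-- Write A_k for the matrix A. Splitting off the first coordinate gives the Kronecker structure
-- A₀ = J ⊗ A₀ and A_{k+1} = J ⊗ A_{k+1} + I ⊗ A_k (Pascal's rule), where J is the all-ones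
-- m × m matrix. The vectors 1 and e₀ − e_j (j ≠ 0) diagonalise J with eigenvalues m and 0,
-- so their tensor products form an eigenbasis of every A_k; the vector indexed by x has
-- eigenvalue m^{n−k} binom(𝒵 x, n−k). An eigenspace, and the image, consist exactly of the
-- vectors whose coordinates in this basis vanish outside the selected basis vectors, so
-- their dimensions are the numbers of such x, counted by the number t of zero coordinates:
-- binom(n, t) (m − 1)^{n−t} vectors have exactly t zeros.

module Submission where

open import Defs
open import Algebra.Bundles using (CommutativeSemiring; CommutativeRing)
open import Data.Nat using (ℕ; zero; suc; _≤_)
open import Data.Product using (_×_; _,_)
open import Data.Rational using (ℚ; 0ℚ)
import Relation.Binary.PropositionalEquality as ≡

module ListSum {c ℓ} (R : CommutativeSemiring c ℓ) where

  open import Level using (Level)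
  open import Data.Nat using (suc)
  open import Data.Fin using (Fin)
  open import Data.Vec using (Vec; _∷_)
  open import Data.List using (List; []; _∷_; _++_; map; concatMap; foldr; allFin)
  open import Function using (_∘_)
  open import Relation.Binary.PropositionalEquality as ≡ using (_≡_)

  open CommutativeSemiring R
  open import Algebra.Properties.CommutativeSemigroup +-commutativeSemigroup using (interchange)
  open import Relation.Binary.Reasoning.Setoid setoid

  private
    variable
      a b : Level
      X : Set a
      Y : Set b

  ∑ˡ : List X → (X → Carrier) → Carrier
  ∑ˡ xs f = foldr _+_ 0# (map f xs)

  syntax ∑ˡ xs (λ x → e) = ∑[ x ∈ xs ] e

  ∑ˡ-cong : ∀ (xs : List X) {f g : X → Carrier} → (∀ x → f x ≈ g x) → ∑ˡ xs f ≈ ∑ˡ xs g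
  ∑ˡ-cong []       f≈g = refl
  ∑ˡ-cong (x ∷ xs) f≈g = +-cong (f≈g x) (∑ˡ-cong xs f≈g)

  ∑ˡ-zero : ∀ (xs : List X) {f : X → Carrier} → (∀ x → f x ≈ 0#) → ∑ˡ xs f ≈ 0#
  ∑ˡ-zero []       f≈0 = refl
  ∑ˡ-zero (x ∷ xs) f≈0 = trans (+-cong (f≈0 x) (∑ˡ-zero xs f≈0)) (+-identityˡ 0#)

  ∑ˡ-distrib-+ : ∀ (xs : List X) (f g : X → Carrier) →
                 ∑[ x ∈ xs ] (f x + g x) ≈ ∑ˡ xs f + ∑ˡ xs g
  ∑ˡ-distrib-+ []       f g = sym (+-identityˡ 0#)
  ∑ˡ-distrib-+ (x ∷ xs) f g =
    trans (+-congˡ (∑ˡ-distrib-+ xs f g)) (interchange (f x) (g x) (∑ˡ xs f) (∑ˡ xs g))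

  *-distribˡ-∑ˡ : ∀ (xs : List X) (u : Carrier) (f : X → Carrier) →
                  u * ∑ˡ xs f ≈ ∑[ x ∈ xs ] (u * f x)
  *-distribˡ-∑ˡ []       u f = zeroʳ u
  *-distribˡ-∑ˡ (x ∷ xs) u f = trans (distribˡ u (f x) (∑ˡ xs f)) (+-congˡ (*-distribˡ-∑ˡ xs u f))

  *-distribʳ-∑ˡ : ∀ (xs : List X) (u : Carrier) (f : X → Carrier) →
                  ∑ˡ xs f * u ≈ ∑[ x ∈ xs ] (f x * u)
  *-distribʳ-∑ˡ []       u f = zeroˡ u
  *-distribʳ-∑ˡ (x ∷ xs) u f = trans (distribʳ u (f x) (∑ˡ xs f)) (+-congˡ (*-distribʳ-∑ˡ xs u f))

  ∑ˡ-++ : ∀ (xs ys : List X) (f : X → Carrier) → ∑ˡ (xs ++ ys) f ≈ ∑ˡ xs f + ∑ˡ ys f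
  ∑ˡ-++ []       ys f = sym (+-identityˡ _)
  ∑ˡ-++ (x ∷ xs) ys f = trans (+-congˡ (∑ˡ-++ xs ys f)) (sym (+-assoc (f x) _ _))

  ∑ˡ-map : (xs : List X) (h : X → Y) (f : Y → Carrier) →
           ∑ˡ (map h xs) f ≡ ∑ˡ xs (f ∘ h)
  ∑ˡ-map []       h f = ≡.refl
  ∑ˡ-map (x ∷ xs) h f rewrite ∑ˡ-map xs h f = ≡.refl

  ∑ˡ-concatMap : (xs : List X) (h : X → List Y) (f : Y → Carrier) →
                 ∑ˡ (concatMap h xs) f ≈ ∑[ x ∈ xs ] ∑ˡ (h x) f
  ∑ˡ-concatMap []       h f = refl
  ∑ˡ-concatMap (x ∷ xs) h f =
    trans (∑ˡ-++ (h x) (concatMap h xs) f) (+-congˡ (∑ˡ-concatMap xs h f))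

  ∑ˡ-comm : (xs : List X) (ys : List Y) (f : X → Y → Carrier) →
            ∑[ x ∈ xs ] ∑[ y ∈ ys ] f x y ≈ ∑[ y ∈ ys ] ∑[ x ∈ xs ] f x y
  ∑ˡ-comm []       ys f = sym (∑ˡ-zero ys (λ _ → refl))
  ∑ˡ-comm (x ∷ xs) ys f = begin
    ∑ˡ ys (f x) + ∑[ x ∈ xs ] ∑[ y ∈ ys ] f x y  ≈⟨ +-congˡ (∑ˡ-comm xs ys f) ⟩
    ∑ˡ ys (f x) + ∑[ y ∈ ys ] ∑[ x ∈ xs ] f x y  ≈⟨ sym (∑ˡ-distrib-+ ys (f x) _) ⟩
    ∑[ y ∈ ys ] (f x y + ∑[ x ∈ xs ] f x y)      ∎

  ∑ˡ-allVecs-∷ : ∀ m n (f : Vec (Fin m) (suc n) → Carrier) →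
                 ∑ˡ (allVecs m (suc n)) f ≈ ∑[ a ∈ allFin m ] ∑[ x ∈ allVecs m n ] f (a ∷ x)
  ∑ˡ-allVecs-∷ m n f = trans (∑ˡ-concatMap (allFin m) (λ a → map (a ∷_) (allVecs m n)) f)
                             (∑ˡ-cong (allFin m) (λ a → reflexive (∑ˡ-map (allVecs m n) (a ∷_) f)))

-- Diagonalisation over ℚ

module _ where

  open import Level using (0ℓ)
  open import Data.Nat as ℕ using (ℕ; zero; suc; _∸_; _<_)
  import Data.Nat.Properties as ℕ
  open import Data.Nat.DivMod using (_%_; n%n≡0; [m+n]%n≡m%n; m<n⇒m%n≡m)
  open import Data.Nat.Combinatorics using (_C_; nCk+nC[k+1]≡[n+1]C[k+1])
  import Data.Integer as ℤ
  import Data.Integer.Properties as ℤ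
  import Data.Integer.Tactic.RingSolver as ℤ-Solver
  open import Data.Fin as Fin using (Fin; zero; suc; punchIn; toℕ)
  open import Data.Fin.Properties using (toℕ-fromℕ<; toℕ-injective; toℕ<n; all?; ¬∀⟶∃¬)
  open import Data.Vec using (Vec; []; _∷_)
  open import Data.Vec.Properties using (∷-injectiveˡ; ∷-injectiveʳ)
  open import Data.Vec.Functional using (insertAt)
  open import Data.Vec.Functional.Properties using (insertAt-lookup; insertAt-punchIn)
  open import Data.List using (List; []; _∷_; map; allFin; tabulate; filter; length; lookup)
  open import Data.List.Relation.Unary.Any as Any using (here)
  open import Data.List.Relation.Unary.Any.Properties using (lookup-index)
  import Data.List.Relation.Unary.All as All
  import Data.List.Relation.Unary.All.Properties as All
  import Data.List.Relation.Unary.AllPairs as AllPairs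
  import Data.List.Relation.Unary.AllPairs.Properties as AllPairs
  open import Data.List.Relation.Unary.Unique.Propositional using (Unique; []; _∷_)
  import Data.List.Relation.Unary.Unique.Propositional.Properties as Unique
  open import Data.List.Relation.Binary.Disjoint.Propositional using (Disjoint)
  open import Data.List.Membership.Propositional using (_∈_)
  open import Data.List.Membership.Propositional.Properties
    using (∈-map⁺; ∈-map⁻; ∈-concatMap⁺; ∈-allFin; ∈-lookup; ∈-filter⁺; ∈-filter⁻)
  open import Data.Maybe using (Maybe; just; nothing)
  open import Data.Product using (Σ; ∃; _,_; proj₁; proj₂)
  open import Data.Rational using (↥_; ℚ; 0ℚ; 1ℚ; _+_; _*_; -_; _-_; 1/_; toℚᵘ; NonZero; ≢-nonZero)
  open import Data.Rational.Properties
  open import Data.Rational.Unnormalised as ℚᵘ using (mkℚᵘ; *≡*)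
  import Data.Rational.Unnormalised.Properties as ℚᵘ
  open import Algebra.Properties.CommutativeSemigroup (CommutativeRing.*-commutativeSemigroup +-*-commutativeRing)
    using (interchange; x∙yz≈y∙xz; xy∙z≈y∙xz)
  open import Algebra.Properties.Semiring.Sum (CommutativeRing.semiring +-*-commutativeRing)
    using (sum-syntax; sum-cong-≗; sum-remove; sum-replicate-zero; ∑-distrib-+; *-distribʳ-sum)
  open import Tactic.RingSolver.Core.AlmostCommutativeRing using (AlmostCommutativeRing; fromCommutativeRing)
  open import Tactic.RingSolver using (solve-∀)
  open import Relation.Binary.Definitions using (tri<; tri≈; tri>)
  open import Relation.Binary.PropositionalEquality
  open import Relation.Nullary using (Dec; ¬_; ¬?; yes; no)
  open import Relation.Nullary.Decidable using (decidable-stable)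
  open import Relation.Nullary.Negation using (contradiction)
  open import Relation.Unary using (Decidable)
  open import Function using (_∘_)

  open ListSum (CommutativeRing.commutativeSemiring +-*-commutativeRing)

  -- Zero coefficients are recognised from the numerator; using _≟_ instead makes normalisation very slow.
  ℚ-ring : AlmostCommutativeRing 0ℓ 0ℓ
  ℚ-ring = fromCommutativeRing +-*-commutativeRing zero?
    where
    zero? : ∀ x → Maybe (0ℚ ≡ x)
    zero? x with ↥ x ℤ.≟ ℤ.0ℤ
    ... | yes ↥x≡0 = just (sym (↥p≡0⇒p≡0 x ↥x≡0))
    ... | no  _    = nothing

  -- ℕ→ℚ a is definitionally fromℚᵘ (mkℚᵘ (+ a) 0).
  ℕ→ℚ-suc : ∀ a → ℕ→ℚ (suc a) ≡ 1ℚ + ℕ→ℚ a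
  ℕ→ℚ-suc a = toℚᵘ-injective (begin
    toℚᵘ (ℕ→ℚ (suc a))         ≈⟨ toℚᵘ-fromℚᵘ (mkℚᵘ (ℤ.+ suc a) 0) ⟩
    mkℚᵘ (ℤ.+ suc a) 0           ≈⟨ *≡* (trans (cong (ℤ._* ℤ.+ 1) (ℤ.pos-+ 1 a)) (cross (ℤ.+ a))) ⟩
    toℚᵘ 1ℚ ℚᵘ.+ mkℚᵘ (ℤ.+ a) 0    ≈⟨ ℚᵘ.+-congʳ (toℚᵘ 1ℚ) (ℚᵘ.≃-sym (toℚᵘ-fromℚᵘ (mkℚᵘ (ℤ.+ a) 0))) ⟩
    toℚᵘ 1ℚ ℚᵘ.+ toℚᵘ (ℕ→ℚ a)   ≈⟨ ℚᵘ.≃-sym (toℚᵘ-homo-+ 1ℚ (ℕ→ℚ a)) ⟩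
    toℚᵘ (1ℚ + ℕ→ℚ a)          ∎)
    where
    open ℚᵘ.≃-Reasoning
    cross : ∀ x → (ℤ.+ 1 ℤ.+ x) ℤ.* ℤ.+ 1 ≡ (ℤ.+ 1 ℤ.* ℤ.+ 1 ℤ.+ x ℤ.* ℤ.+ 1) ℤ.* ℤ.+ 1
    cross = ℤ-Solver.solve-∀

  ℕ→ℚ-+ : ∀ a b → ℕ→ℚ (a ℕ.+ b) ≡ ℕ→ℚ a + ℕ→ℚ b
  ℕ→ℚ-+ zero    b = sym (+-identityˡ (ℕ→ℚ b))
  ℕ→ℚ-+ (suc a) b = begin
    ℕ→ℚ (suc (a ℕ.+ b))         ≡⟨ ℕ→ℚ-suc (a ℕ.+ b) ⟩
    1ℚ + ℕ→ℚ (a ℕ.+ b)          ≡⟨ cong (1ℚ +_) (ℕ→ℚ-+ a b) ⟩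
    1ℚ + (ℕ→ℚ a + ℕ→ℚ b)        ≡⟨ +-assoc 1ℚ (ℕ→ℚ a) (ℕ→ℚ b) ⟨
    (1ℚ + ℕ→ℚ a) + ℕ→ℚ b        ≡⟨ cong (_+ ℕ→ℚ b) (ℕ→ℚ-suc a) ⟨
    ℕ→ℚ (suc a) + ℕ→ℚ b         ∎
    where open ≡-Reasoning

  ℕ→ℚ-suc-* : ∀ a u → ℕ→ℚ (suc a) * u ≡ u + ℕ→ℚ a * u
  ℕ→ℚ-suc-* a u = begin
    ℕ→ℚ (suc a) * u        ≡⟨ cong (_* u) (ℕ→ℚ-suc a) ⟩
    (1ℚ + ℕ→ℚ a) * u       ≡⟨ *-distribʳ-+ u 1ℚ (ℕ→ℚ a) ⟩
    1ℚ * u + ℕ→ℚ a * u     ≡⟨ cong (_+ ℕ→ℚ a * u) (*-identityˡ u) ⟩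
    u + ℕ→ℚ a * u          ∎
    where open ≡-Reasoning

  ℕ→ℚ-* : ∀ a b → ℕ→ℚ (a ℕ.* b) ≡ ℕ→ℚ a * ℕ→ℚ b
  ℕ→ℚ-* zero    b = sym (*-zeroˡ (ℕ→ℚ b))
  ℕ→ℚ-* (suc a) b = begin
    ℕ→ℚ (b ℕ.+ a ℕ.* b)      ≡⟨ ℕ→ℚ-+ b (a ℕ.* b) ⟩
    ℕ→ℚ b + ℕ→ℚ (a ℕ.* b)    ≡⟨ cong (ℕ→ℚ b +_) (ℕ→ℚ-* a b) ⟩
    ℕ→ℚ b + ℕ→ℚ a * ℕ→ℚ b    ≡⟨ ℕ→ℚ-suc-* a (ℕ→ℚ b) ⟨
    ℕ→ℚ (suc a) * ℕ→ℚ b      ∎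
    where open ≡-Reasoning

  ℕ→ℚ-≢0 : ∀ a .{{_ : ℕ.NonZero a}} → ℕ→ℚ a ≢ 0ℚ
  ℕ→ℚ-≢0 a = <⇒≢ (positive⁻¹ (ℕ→ℚ a) {{normalize-pos a 1}}) ∘ sym

  *-cancelʳ-≡ : ∀ p q r .{{_ : NonZero r}} → p * r ≡ q * r → p ≡ q
  *-cancelʳ-≡ p q r pr≡qr = begin
    p                  ≡⟨ *-identityʳ p ⟨
    p * 1ℚ             ≡⟨ cong (p *_) (*-inverseʳ r) ⟨
    p * (r * 1/ r)     ≡⟨ *-assoc p r (1/ r) ⟨
    p * r * 1/ r       ≡⟨ cong (_* 1/ r) pr≡qr ⟩
    q * r * 1/ r       ≡⟨ *-assoc q r (1/ r) ⟩
    q * (r * 1/ r)     ≡⟨ cong (q *_) (*-inverseʳ r) ⟩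
    q * 1ℚ             ≡⟨ *-identityʳ q ⟩
    q                  ∎
    where open ≡-Reasoning

  ∑ˡ-tabulate : ∀ {a} {X : Set a} {n} (g : Fin n → X) (f : X → ℚ) →
                ∑ˡ (tabulate g) f ≡ ∑[ i < n ] f (g i)
  ∑ˡ-tabulate {n = zero}  g f = refl
  ∑ˡ-tabulate {n = suc n} g f = cong (f (g zero) +_) (∑ˡ-tabulate (g ∘ suc) f)

  ∑ˡ-allFin : ∀ n (f : Fin n → ℚ) → ∑ˡ (allFin n) f ≡ ∑[ i < n ] f i
  ∑ˡ-allFin n = ∑ˡ-tabulate (λ i → i)

  ∑ˡ-linear : ∀ {a b} {X : Set a} {Y : Set b} (xs : List X) (ys : List Y)
              (K : X → ℚ) (c : Y → ℚ) (w : Y → X → ℚ) →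
              ∑[ x ∈ xs ] (K x * ∑[ y ∈ ys ] (c y * w y x)) ≡ ∑[ y ∈ ys ] (c y * ∑[ x ∈ xs ] (K x * w y x))
  ∑ˡ-linear xs ys K c w = begin
    ∑[ x ∈ xs ] (K x * ∑[ y ∈ ys ] (c y * w y x))
      ≡⟨ ∑ˡ-cong xs (λ x → *-distribˡ-∑ˡ ys (K x) (λ y → c y * w y x)) ⟩
    ∑[ x ∈ xs ] ∑[ y ∈ ys ] (K x * (c y * w y x))
      ≡⟨ ∑ˡ-cong xs (λ x → ∑ˡ-cong ys (λ y → x∙yz≈y∙xz (K x) (c y) (w y x))) ⟩
    ∑[ x ∈ xs ] ∑[ y ∈ ys ] (c y * (K x * w y x))
      ≡⟨ ∑ˡ-comm xs ys (λ x y → c y * (K x * w y x)) ⟩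
    ∑[ y ∈ ys ] ∑[ x ∈ xs ] (c y * (K x * w y x))
      ≡⟨ ∑ˡ-cong ys (λ y → *-distribˡ-∑ˡ xs (c y) (λ x → K x * w y x)) ⟨
    ∑[ y ∈ ys ] (c y * ∑[ x ∈ xs ] (K x * w y x))  ∎
    where open ≡-Reasoning

  ∑ˡ-scale : ∀ {a} {X : Set a} (xs : List X) (K : X → ℚ) (u : ℚ) (v : X → ℚ) →
             ∑[ x ∈ xs ] (K x * (u * v x)) ≡ u * ∑[ x ∈ xs ] (K x * v x)
  ∑ˡ-scale xs K u v = trans (∑ˡ-cong xs (λ x → x∙yz≈y∙xz (K x) u (v x))) (sym (*-distribˡ-∑ˡ xs u (λ x → K x * v x)))

  ∑ᵥ-∷ : ∀ m n (f : Vec (Fin m) (suc n) → ℚ) →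
         ∑ˡ (allVecs m (suc n)) f ≡ ∑[ a < m ] ∑[ x ∈ allVecs m n ] f (a ∷ x)
  ∑ᵥ-∷ m n f = trans (∑ˡ-allVecs-∷ m n f) (∑ˡ-allFin m (λ a → ∑[ x ∈ allVecs m n ] f (a ∷ x)))

  ∑-∑ˡ-tensor : ∀ {a} {X : Set a} m (xs : List X) (g₁ g₂ : Fin m → ℚ) (h₁ h₂ : X → ℚ) →
    ∑[ i < m ] ∑[ x ∈ xs ] ((g₁ i * h₁ x) * (g₂ i * h₂ x))
      ≡ (∑[ i < m ] (g₁ i * g₂ i)) * ∑[ x ∈ xs ] (h₁ x * h₂ x)
  ∑-∑ˡ-tensor m xs g₁ g₂ h₁ h₂ = begin
    ∑[ i < m ] ∑[ x ∈ xs ] ((g₁ i * h₁ x) * (g₂ i * h₂ x))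
      ≡⟨ sum-cong-≗ (λ i → ∑ˡ-cong xs (λ x → interchange (g₁ i) (h₁ x) (g₂ i) (h₂ x))) ⟩
    ∑[ i < m ] ∑[ x ∈ xs ] ((g₁ i * g₂ i) * (h₁ x * h₂ x))
      ≡⟨ sum-cong-≗ (λ i → *-distribˡ-∑ˡ xs (g₁ i * g₂ i) (λ x → h₁ x * h₂ x)) ⟨
    ∑[ i < m ] ((g₁ i * g₂ i) * ∑[ x ∈ xs ] (h₁ x * h₂ x))
      ≡⟨ *-distribʳ-sum (∑[ x ∈ xs ] (h₁ x * h₂ x)) (λ i → g₁ i * g₂ i) ⟨
    (∑[ i < m ] (g₁ i * g₂ i)) * ∑[ x ∈ xs ] (h₁ x * h₂ x)  ∎
    where open ≡-Reasoning

  ∑-const : ∀ n (u : ℚ) → ∑[ i < n ] u ≡ ℕ→ℚ n * u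
  ∑-const zero    u = sym (*-zeroˡ u)
  ∑-const (suc n) u = trans (cong (u +_) (∑-const n u)) (sym (ℕ→ℚ-suc-* n u))

  ∑-zero : ∀ n {f : Fin n → ℚ} → (∀ i → f i ≡ 0ℚ) → ∑[ i < n ] f i ≡ 0ℚ
  ∑-zero n f≡0 = trans (sum-cong-≗ f≡0) (sum-replicate-zero n)

  ∑-distrib-- : ∀ n (f g : Fin n → ℚ) → ∑[ i < n ] (f i - g i) ≡ ∑[ i < n ] f i - ∑[ i < n ] g i
  ∑-distrib-- zero    f g = refl
  ∑-distrib-- (suc n) f g = begin
    (f zero - g zero) + ∑[ i < n ] (f (suc i) - g (suc i))
      ≡⟨ cong ((f zero - g zero) +_) (∑-distrib-- n (f ∘ suc) (g ∘ suc)) ⟩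
    (f zero - g zero) + (∑[ i < n ] f (suc i) - ∑[ i < n ] g (suc i))
      ≡⟨ regroup (f zero) (g zero) (∑[ i < n ] f (suc i)) (∑[ i < n ] g (suc i)) ⟩
    (f zero + ∑[ i < n ] f (suc i)) - (g zero + ∑[ i < n ] g (suc i))  ∎
    where
    open ≡-Reasoning
    regroup : ∀ a b c d → (a - b) + (c - d) ≡ (a + c) - (b + d)
    regroup = solve-∀ ℚ-ring

  δ : ∀ {n} → Fin n → Fin n → ℚ
  δ zero    zero    = 1ℚ
  δ zero    (suc _) = 0ℚ
  δ (suc _) zero    = 0ℚ
  δ (suc i) (suc j) = δ i j

  δ-sym : ∀ {n} (i j : Fin n) → δ i j ≡ δ j i
  δ-sym zero    zero    = refl
  δ-sym zero    (suc _) = refl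
  δ-sym (suc _) zero    = refl
  δ-sym (suc i) (suc j) = δ-sym i j

  δ-refl : ∀ {n} (i : Fin n) → δ i i ≡ 1ℚ
  δ-refl zero    = refl
  δ-refl (suc i) = δ-refl i

  δ-≡ : ∀ {n} {i j : Fin n} → i ≡ j → δ i j ≡ 1ℚ
  δ-≡ {i = i} refl = δ-refl i

  δ-≢ : ∀ {n} {i j : Fin n} → i ≢ j → δ i j ≡ 0ℚ
  δ-≢ {i = zero}  {zero}  i≢j = contradiction refl i≢j
  δ-≢ {i = zero}  {suc _} _   = refl
  δ-≢ {i = suc _} {zero}  _   = refl
  δ-≢ {i = suc i} {suc j} i≢j = δ-≢ (i≢j ∘ cong suc)

  ∑-δ : ∀ {n} (j : Fin n) (f : Fin n → ℚ) → ∑[ i < n ] (δ i j * f i) ≡ f j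
  ∑-δ {suc n} zero    f = begin
    1ℚ * f zero + ∑[ i < n ] (0ℚ * f (suc i))
      ≡⟨ cong₂ _+_ (*-identityˡ (f zero)) (∑-zero n (λ i → *-zeroˡ (f (suc i)))) ⟩
    f zero + 0ℚ
      ≡⟨ +-identityʳ (f zero) ⟩
    f zero  ∎
    where open ≡-Reasoning
  ∑-δ {suc n} (suc j) f = begin
    0ℚ * f zero + ∑[ i < n ] (δ i j * f (suc i))  ≡⟨ cong₂ _+_ (*-zeroˡ (f zero)) (∑-δ j (f ∘ suc)) ⟩
    0ℚ + f (suc j)                               ≡⟨ +-identityˡ (f (suc j)) ⟩
    f (suc j)                                    ∎
    where open ≡-Reasoning

  ∑-δ-1 : ∀ {n} (j : Fin n) → ∑[ i < n ] δ i j ≡ 1ℚ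
  ∑-δ-1 j = trans (sum-cong-≗ (λ i → sym (*-identityʳ (δ i j)))) (∑-δ j (λ _ → 1ℚ))

  δⁿ : ∀ {m n} → Vec (Fin m) n → Vec (Fin m) n → ℚ
  δⁿ []      []      = 1ℚ
  δⁿ (a ∷ x) (b ∷ y) = δ a b * δⁿ x y

  δⁿ-sym : ∀ {m n} (x y : Vec (Fin m) n) → δⁿ x y ≡ δⁿ y x
  δⁿ-sym []      []      = refl
  δⁿ-sym (a ∷ x) (b ∷ y) = cong₂ _*_ (δ-sym a b) (δⁿ-sym x y)

  δⁿ-refl : ∀ {m n} (x : Vec (Fin m) n) → δⁿ x x ≡ 1ℚ
  δⁿ-refl []      = refl
  δⁿ-refl (a ∷ x) = cong₂ _*_ (δ-refl a) (δⁿ-refl x)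

  δⁿ-≢ : ∀ {m n} {x y : Vec (Fin m) n} → x ≢ y → δⁿ x y ≡ 0ℚ
  δⁿ-≢ {x = []}    {[]}    x≢y = contradiction refl x≢y
  δⁿ-≢ {x = a ∷ x} {b ∷ y} x≢y with a Fin.≟ b
  ... | yes refl = trans (cong (δ a a *_) (δⁿ-≢ (x≢y ∘ cong (a ∷_)))) (*-zeroʳ (δ a a))
  ... | no a≢b   = trans (cong (_* δⁿ x y) (δ-≢ a≢b)) (*-zeroˡ (δⁿ x y))

  ∑-δⁿ : ∀ {m n} (y : Vec (Fin m) n) (v : Vec (Fin m) n → ℚ) →
         ∑[ x ∈ allVecs m n ] (δⁿ x y * v x) ≡ v y
  ∑-δⁿ []      v = trans (+-identityʳ (1ℚ * v [])) (*-identityˡ (v []))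
  ∑-δⁿ {m} {suc n} (b ∷ y) v = begin
    ∑ˡ (allVecs m (suc n)) (λ x → δⁿ x (b ∷ y) * v x)
      ≡⟨ ∑ᵥ-∷ m n _ ⟩
    ∑[ a < m ] ∑[ x ∈ allVecs m n ] ((δ a b * δⁿ x y) * v (a ∷ x))
      ≡⟨ sum-cong-≗ (λ a → ∑ˡ-cong (allVecs m n) (λ x → *-assoc (δ a b) (δⁿ x y) (v (a ∷ x)))) ⟩
    ∑[ a < m ] ∑[ x ∈ allVecs m n ] (δ a b * (δⁿ x y * v (a ∷ x)))
      ≡⟨ sum-cong-≗ (λ a → *-distribˡ-∑ˡ (allVecs m n) (δ a b) (λ x → δⁿ x y * v (a ∷ x))) ⟨
    ∑[ a < m ] (δ a b * ∑[ x ∈ allVecs m n ] (δⁿ x y * v (a ∷ x)))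
      ≡⟨ sum-cong-≗ (λ a → cong (δ a b *_) (∑-δⁿ y (v ∘ (a ∷_)))) ⟩
    ∑[ a < m ] (δ a b * v (a ∷ y))
      ≡⟨ ∑-δ b (λ a → v (a ∷ y)) ⟩
    v (b ∷ y)  ∎
    where open ≡-Reasoning

  module OneDimensional (m' : ℕ) where

    private
      M = suc m'
      instance
        M≢0 = ≢-nonZero (ℕ→ℚ-≢0 M)

    M⁻¹ : ℚ
    M⁻¹ = 1/ ℕ→ℚ M

    M⁻¹*M≡1 : M⁻¹ * ℕ→ℚ M ≡ 1ℚ
    M⁻¹*M≡1 = *-inverseˡ (ℕ→ℚ M)

    basis₁ : Fin M → Fin M → ℚ
    basis₁ zero    _ = 1ℚ
    basis₁ (suc j) b = δ b zero - δ b (suc j)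

    dual₁ : Fin M → Fin M → ℚ
    dual₁ zero    _ = M⁻¹
    dual₁ (suc j) b = M⁻¹ - δ b (suc j)

    ∑-basis₁ : ∀ c → ∑[ b < M ] basis₁ c b ≡ ℕ→ℚ M * δ zero c
    ∑-basis₁ zero    = ∑-const M 1ℚ
    ∑-basis₁ (suc j) = begin
      ∑[ b < M ] (δ b zero - δ b (suc j))           ≡⟨ ∑-distrib-- M (λ b → δ b zero) (λ b → δ b (suc j)) ⟩
      ∑[ b < M ] δ b zero - ∑[ b < M ] δ b (suc j)  ≡⟨ cong₂ _-_ (∑-δ-1 {M} zero) (∑-δ-1 (suc j)) ⟩
      1ℚ - 1ℚ                                       ≡⟨ *-zeroʳ (ℕ→ℚ M) ⟨
      ℕ→ℚ M * 0ℚ                                    ∎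
      where open ≡-Reasoning

    ∑-dual₁ : ∀ a → ∑[ b < M ] dual₁ a b ≡ δ zero a
    ∑-dual₁ zero    = trans (∑-const M M⁻¹) (trans (*-comm (ℕ→ℚ M) M⁻¹) M⁻¹*M≡1)
    ∑-dual₁ (suc j) = begin
      ∑[ b < M ] (M⁻¹ - δ b (suc j))                 ≡⟨ ∑-distrib-- M (λ _ → M⁻¹) (λ b → δ b (suc j)) ⟩
      ∑[ b < M ] M⁻¹ - ∑[ b < M ] δ b (suc j)        ≡⟨ cong₂ _-_ (∑-const M M⁻¹) (∑-δ-1 (suc j)) ⟩
      ℕ→ℚ M * M⁻¹ - 1ℚ                              ≡⟨ cong (_- 1ℚ) (trans (*-comm (ℕ→ℚ M) M⁻¹) M⁻¹*M≡1) ⟩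
      1ℚ - 1ℚ                                      ∎
      where open ≡-Reasoning

    ∑-basis₁-suc-* : ∀ i (v : Fin M → ℚ) → ∑[ b < M ] (basis₁ (suc i) b * v b) ≡ v zero - v (suc i)
    ∑-basis₁-suc-* i v = begin
      ∑[ b < M ] ((δ b zero - δ b (suc i)) * v b)
        ≡⟨ sum-cong-≗ (λ b → *-distribʳ-- (δ b zero) (δ b (suc i)) (v b)) ⟩
      ∑[ b < M ] (δ b zero * v b - δ b (suc i) * v b)
        ≡⟨ ∑-distrib-- M (λ b → δ b zero * v b) (λ b → δ b (suc i) * v b) ⟩
      ∑[ b < M ] (δ b zero * v b) - ∑[ b < M ] (δ b (suc i) * v b)
        ≡⟨ cong₂ _-_ (∑-δ zero v) (∑-δ (suc i) v) ⟩
      v zero - v (suc i)  ∎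
      where
      open ≡-Reasoning
      *-distribʳ-- : ∀ a b c → (a - b) * c ≡ a * c - b * c
      *-distribʳ-- = solve-∀ ℚ-ring

    dual₁-basis₁ : ∀ a c → ∑[ b < M ] (dual₁ a b * basis₁ c b) ≡ δ a c
    dual₁-basis₁ a zero    = trans (sum-cong-≗ (λ b → *-identityʳ (dual₁ a b))) (trans (∑-dual₁ a) (δ-sym zero a))
    dual₁-basis₁ a (suc i) = trans (sum-cong-≗ (λ b → *-comm (dual₁ a b) (basis₁ (suc i) b)))
                                   (trans (∑-basis₁-suc-* i (dual₁ a)) (differences a))
      where
      cancel : ∀ x z d → (x - z) - (x - d) ≡ d - z
      cancel = solve-∀ ℚ-ring
      differences : ∀ a → dual₁ a zero - dual₁ a (suc i) ≡ δ a (suc i)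
      differences zero    = +-inverseʳ M⁻¹
      differences (suc j) = trans (cancel M⁻¹ 0ℚ (δ i j)) (trans (+-identityʳ (δ i j)) (δ-sym i j))

    ∑-dual₁-column : ∀ c → ∑[ a < M ] dual₁ a c ≡ δ c zero
    ∑-dual₁-column c = begin
      M⁻¹ + ∑[ j < m' ] (M⁻¹ - δ c (suc j))
        ≡⟨ cong (M⁻¹ +_) (∑-distrib-- m' (λ _ → M⁻¹) (λ j → δ c (suc j))) ⟩
      M⁻¹ + (∑[ j < m' ] M⁻¹ - ∑[ j < m' ] δ c (suc j))
        ≡⟨ cong (λ s → M⁻¹ + (s - ∑[ j < m' ] δ c (suc j))) (∑-const m' M⁻¹) ⟩
      M⁻¹ + (ℕ→ℚ m' * M⁻¹ - ∑[ j < m' ] δ c (suc j))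
        ≡⟨ +-assoc M⁻¹ (ℕ→ℚ m' * M⁻¹) _ ⟨
      (M⁻¹ + ℕ→ℚ m' * M⁻¹) - ∑[ j < m' ] δ c (suc j)
        ≡⟨ cong (_- ∑[ j < m' ] δ c (suc j)) M⁻¹+m'*M⁻¹≡1 ⟩
      1ℚ - ∑[ j < m' ] δ c (suc j)
        ≡⟨ complement c ⟩
      δ c zero  ∎
      where
      open ≡-Reasoning
      M⁻¹+m'*M⁻¹≡1 : M⁻¹ + ℕ→ℚ m' * M⁻¹ ≡ 1ℚ
      M⁻¹+m'*M⁻¹≡1 = trans (sym (ℕ→ℚ-suc-* m' M⁻¹)) (trans (*-comm (ℕ→ℚ M) M⁻¹) M⁻¹*M≡1)
      complement : ∀ c → 1ℚ - ∑[ j < m' ] δ c (suc j) ≡ δ c zero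
      complement zero    = cong (λ s → 1ℚ - s) (∑-zero m' (λ _ → refl))
      complement (suc q) = cong (λ s → 1ℚ - s) (trans (sum-cong-≗ (δ-sym q)) (∑-δ-1 q))

    ∑-dual₁-basis₁ : ∀ c b → ∑[ a < M ] (dual₁ a c * basis₁ a b) ≡ δ c b
    ∑-dual₁-basis₁ c zero    = trans (sum-cong-≗ (λ a → trans (cong (dual₁ a c *_) (basis₁-zero a)) (*-identityʳ (dual₁ a c))))
                                     (∑-dual₁-column c)
      where
      basis₁-zero : ∀ a → basis₁ a zero ≡ 1ℚ
      basis₁-zero zero    = refl
      basis₁-zero (suc _) = refl
    ∑-dual₁-basis₁ c (suc p) = begin
      M⁻¹ * 1ℚ + ∑[ j < m' ] (g j * (0ℚ - δ p j))
        ≡⟨ cong (M⁻¹ * 1ℚ +_) (sum-cong-≗ (λ j → trans (negate (g j) (δ p j)) (cong (λ d → 0ℚ - d * g j) (δ-sym p j)))) ⟩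
      M⁻¹ * 1ℚ + ∑[ j < m' ] (0ℚ - δ j p * g j)
        ≡⟨ cong (M⁻¹ * 1ℚ +_) (∑-distrib-- m' (λ _ → 0ℚ) (λ j → δ j p * g j)) ⟩
      M⁻¹ * 1ℚ + (∑[ j < m' ] 0ℚ - ∑[ j < m' ] (δ j p * g j))
        ≡⟨ cong₂ (λ z s → M⁻¹ * 1ℚ + (z - s)) (∑-zero m' (λ _ → refl)) (∑-δ p g) ⟩
      M⁻¹ * 1ℚ + (0ℚ - g p)
        ≡⟨ cancel M⁻¹ (δ c (suc p)) ⟩
      δ c (suc p)  ∎
      where
      open ≡-Reasoning
      g : Fin m' → ℚ
      g j = M⁻¹ - δ c (suc j)
      negate : ∀ x d → x * (0ℚ - d) ≡ 0ℚ - d * x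
      negate = solve-∀ ℚ-ring
      cancel : ∀ x d → x * 1ℚ + (0ℚ - (x - d)) ≡ d
      cancel = solve-∀ ℚ-ring

  module TensorBasis (m' : ℕ) where

    open OneDimensional m' public

    private
      M = suc m'

    basis : ∀ {n} → Vec (Fin M) n → Vec (Fin M) n → ℚ
    basis []      []      = 1ℚ
    basis (a ∷ x) (b ∷ f) = basis₁ a b * basis x f

    dual : ∀ {n} → Vec (Fin M) n → Vec (Fin M) n → ℚ
    dual []      []      = 1ℚ
    dual (a ∷ x) (b ∷ f) = dual₁ a b * dual x f

    dual-basis : ∀ {n} (x y : Vec (Fin M) n) → ∑[ f ∈ allVecs M n ] (dual x f * basis y f) ≡ δⁿ x y
    dual-basis []      []      = +-identityʳ 1ℚ
    dual-basis {suc n} (a ∷ x) (c ∷ y) = begin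
      ∑ˡ (allVecs M (suc n)) (λ f → dual (a ∷ x) f * basis (c ∷ y) f)
        ≡⟨ ∑ᵥ-∷ M n _ ⟩
      ∑[ b < M ] ∑[ f ∈ allVecs M n ] ((dual₁ a b * dual x f) * (basis₁ c b * basis y f))
        ≡⟨ ∑-∑ˡ-tensor M (allVecs M n) (dual₁ a) (basis₁ c) (dual x) (basis y) ⟩
      (∑[ b < M ] (dual₁ a b * basis₁ c b)) * ∑[ f ∈ allVecs M n ] (dual x f * basis y f)
        ≡⟨ cong₂ _*_ (dual₁-basis₁ a c) (dual-basis x y) ⟩
      δ a c * δⁿ x y  ∎
      where open ≡-Reasoning

    ∑-dual-basis : ∀ {n} (g f : Vec (Fin M) n) → ∑[ x ∈ allVecs M n ] (dual x g * basis x f) ≡ δⁿ g f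
    ∑-dual-basis []      []      = +-identityʳ 1ℚ
    ∑-dual-basis {suc n} (c ∷ g) (b ∷ f) = begin
      ∑ˡ (allVecs M (suc n)) (λ x → dual x (c ∷ g) * basis x (b ∷ f))
        ≡⟨ ∑ᵥ-∷ M n _ ⟩
      ∑[ a < M ] ∑[ x ∈ allVecs M n ] ((dual₁ a c * dual x g) * (basis₁ a b * basis x f))
        ≡⟨ ∑-∑ˡ-tensor M (allVecs M n) (λ a → dual₁ a c) (λ a → basis₁ a b) (λ x → dual x g) (λ x → basis x f) ⟩
      (∑[ a < M ] (dual₁ a c * basis₁ a b)) * ∑[ x ∈ allVecs M n ] (dual x g * basis x f)
        ≡⟨ cong₂ _*_ (∑-dual₁-basis₁ c b) (∑-dual-basis g f) ⟩
      δ c b * δⁿ g f  ∎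
      where open ≡-Reasoning

    coord : ∀ {n} → (Vec (Fin M) n → ℚ) → Vec (Fin M) n → ℚ
    coord {n} v x = ∑[ f ∈ allVecs M n ] (dual x f * v f)

    basis-expansion : ∀ {n} (v : Vec (Fin M) n → ℚ) f → ∑[ x ∈ allVecs M n ] (coord v x * basis x f) ≡ v f
    basis-expansion {n} v f = begin
      ∑[ x ∈ Vs ] (coord v x * basis x f)
        ≡⟨ ∑ˡ-cong Vs (λ x → *-distribʳ-∑ˡ Vs (basis x f) (λ g → dual x g * v g)) ⟩
      ∑[ x ∈ Vs ] ∑[ g ∈ Vs ] ((dual x g * v g) * basis x f)
        ≡⟨ ∑ˡ-cong Vs (λ x → ∑ˡ-cong Vs (λ g → xy∙z≈y∙xz (dual x g) (v g) (basis x f))) ⟩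
      ∑[ x ∈ Vs ] ∑[ g ∈ Vs ] (v g * (dual x g * basis x f))
        ≡⟨ ∑ˡ-comm Vs Vs (λ x g → v g * (dual x g * basis x f)) ⟩
      ∑[ g ∈ Vs ] ∑[ x ∈ Vs ] (v g * (dual x g * basis x f))
        ≡⟨ ∑ˡ-cong Vs (λ g → *-distribˡ-∑ˡ Vs (v g) (λ x → dual x g * basis x f)) ⟨
      ∑[ g ∈ Vs ] (v g * ∑[ x ∈ Vs ] (dual x g * basis x f))
        ≡⟨ ∑ˡ-cong Vs (λ g → trans (cong (v g *_) (∑-dual-basis g f)) (*-comm (v g) (δⁿ g f))) ⟩
      ∑[ g ∈ Vs ] (δⁿ g f * v g)
        ≡⟨ ∑-δⁿ f v ⟩
      v f  ∎
      where
      open ≡-Reasoning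
      Vs = allVecs M n

  module _ {m' : ℕ} where

    private
      M = suc m'

    toℕ-subZ : ∀ (b c : Fin M) → toℕ (subZ b c) ≡ (toℕ b ℕ.+ M ∸ toℕ c) % M
    toℕ-subZ b c = toℕ-fromℕ< _

    subZ-self : ∀ (b : Fin M) → subZ b b ≡ zero
    subZ-self b = toℕ-injective (begin
      toℕ (subZ b b)              ≡⟨ toℕ-subZ b b ⟩
      (toℕ b ℕ.+ M ∸ toℕ b) % M   ≡⟨ cong (_% M) (ℕ.m+n∸m≡n (toℕ b) M) ⟩
      M % M                       ≡⟨ n%n≡0 M ⟩
      0                           ∎)
      where open ≡-Reasoning

    subZ≡zero⇒≡ : ∀ (b c : Fin M) → subZ b c ≡ zero → b ≡ c
    subZ≡zero⇒≡ b c subZ≡0 with ℕ.<-cmp (toℕ b) (toℕ c)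
    ... | tri≈ _ b≡c _ = toℕ-injective b≡c
    ... | tri< b<c _ _ = contradiction c<b+M (ℕ.≤⇒≯ (ℕ.m∸n≡0⇒m≤n (trans (sym s%M≡s) s%M≡0)))
      where
      s%M≡0 : (toℕ b ℕ.+ M ∸ toℕ c) % M ≡ 0
      s%M≡0 = trans (sym (toℕ-subZ b c)) (cong toℕ subZ≡0)
      s%M≡s : (toℕ b ℕ.+ M ∸ toℕ c) % M ≡ toℕ b ℕ.+ M ∸ toℕ c
      s%M≡s = m<n⇒m%n≡m (ℕ.m<n+o⇒m∸n<o (toℕ b ℕ.+ M) (toℕ c) (ℕ.+-monoˡ-< M b<c))
      c<b+M : toℕ c < toℕ b ℕ.+ M
      c<b+M = ℕ.<-≤-trans (toℕ<n c) (ℕ.m≤n+m M (toℕ b))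
    ... | tri> _ _ c<b = contradiction c<b (ℕ.≤⇒≯ (ℕ.m∸n≡0⇒m≤n (begin
      toℕ b ∸ toℕ c                   ≡⟨ m<n⇒m%n≡m (ℕ.≤-<-trans (ℕ.m∸n≤m (toℕ b) (toℕ c)) (toℕ<n b)) ⟨
      (toℕ b ∸ toℕ c) % M             ≡⟨ [m+n]%n≡m%n (toℕ b ∸ toℕ c) M ⟨
      (toℕ b ∸ toℕ c ℕ.+ M) % M       ≡⟨ cong (_% M) (ℕ.+-∸-comm M (ℕ.<⇒≤ c<b)) ⟨
      (toℕ b ℕ.+ M ∸ toℕ c) % M       ≡⟨ toℕ-subZ b c ⟨
      toℕ (subZ b c)                  ≡⟨ cong toℕ subZ≡0 ⟩
      0                               ∎)))
      where open ≡-Reasoning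

    𝒵-subZ-≡-∷ : ∀ {n} {b c : Fin M} (r : Vec (Fin M) n) → b ≡ c → 𝒵 (subZ b c ∷ r) ≡ suc (𝒵 r)
    𝒵-subZ-≡-∷ {b = b} r refl = cong (λ a → 𝒵 (a ∷ r)) (subZ-self b)

    𝒵-subZ-≢-∷ : ∀ {n} {b c : Fin M} (r : Vec (Fin M) n) → b ≢ c → 𝒵 (subZ b c ∷ r) ≡ 𝒵 r
    𝒵-subZ-≢-∷ {b = b} {c} r b≢c with subZ b c in eq
    ... | zero  = contradiction (subZ≡zero⇒≡ b c eq) b≢c
    ... | suc _ = refl

    A-suc-∷ : ∀ {n} k (b c : Fin M) (f g : Vec (Fin M) n) →
              A (suc k) (c ∷ f) (b ∷ g) ≡ A (suc k) f g + δ b c * A k f g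
    A-suc-∷ k b c f g = by-cases (b Fin.≟ c)
      where
      open ≡-Reasoning
      r = g ⊖ f
      by-cases : Dec (b ≡ c) → A (suc k) (c ∷ f) (b ∷ g) ≡ A (suc k) f g + δ b c * A k f g
      by-cases (yes b≡c) = begin
        ℕ→ℚ (𝒵 (subZ b c ∷ r) C suc k)
          ≡⟨ cong (λ z → ℕ→ℚ (z C suc k)) (𝒵-subZ-≡-∷ r b≡c) ⟩
        ℕ→ℚ (suc (𝒵 r) C suc k)
          ≡⟨ cong ℕ→ℚ (nCk+nC[k+1]≡[n+1]C[k+1] (𝒵 r) k) ⟨
        ℕ→ℚ (𝒵 r C k ℕ.+ 𝒵 r C suc k)
          ≡⟨ ℕ→ℚ-+ (𝒵 r C k) (𝒵 r C suc k) ⟩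
        ℕ→ℚ (𝒵 r C k) + ℕ→ℚ (𝒵 r C suc k)
          ≡⟨ +-comm (ℕ→ℚ (𝒵 r C k)) (ℕ→ℚ (𝒵 r C suc k)) ⟩
        ℕ→ℚ (𝒵 r C suc k) + ℕ→ℚ (𝒵 r C k)
          ≡⟨ cong (ℕ→ℚ (𝒵 r C suc k) +_) (*-identityˡ (ℕ→ℚ (𝒵 r C k))) ⟨
        ℕ→ℚ (𝒵 r C suc k) + 1ℚ * ℕ→ℚ (𝒵 r C k)
          ≡⟨ cong (λ d → ℕ→ℚ (𝒵 r C suc k) + d * ℕ→ℚ (𝒵 r C k)) (δ-≡ b≡c) ⟨
        ℕ→ℚ (𝒵 r C suc k) + δ b c * ℕ→ℚ (𝒵 r C k)  ∎
      by-cases (no b≢c) = begin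
        ℕ→ℚ (𝒵 (subZ b c ∷ r) C suc k)
          ≡⟨ cong (λ z → ℕ→ℚ (z C suc k)) (𝒵-subZ-≢-∷ r b≢c) ⟩
        ℕ→ℚ (𝒵 r C suc k)
          ≡⟨ +-identityʳ (ℕ→ℚ (𝒵 r C suc k)) ⟨
        ℕ→ℚ (𝒵 r C suc k) + 0ℚ
          ≡⟨ cong (ℕ→ℚ (𝒵 r C suc k) +_) (*-zeroˡ (ℕ→ℚ (𝒵 r C k))) ⟨
        ℕ→ℚ (𝒵 r C suc k) + 0ℚ * ℕ→ℚ (𝒵 r C k)
          ≡⟨ cong (λ d → ℕ→ℚ (𝒵 r C suc k) + d * ℕ→ℚ (𝒵 r C k)) (δ-≢ b≢c) ⟨
        ℕ→ℚ (𝒵 r C suc k) + δ b c * ℕ→ℚ (𝒵 r C k)  ∎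

    ∑-A-⊗-zero : ∀ {n} (c : Fin M) (f : Vec (Fin M) n) (u : Fin M → ℚ) (v : Vec (Fin M) n → ℚ) →
      ∑[ b < M ] ∑[ g ∈ allVecs M n ] (A 0 (c ∷ f) (b ∷ g) * (u b * v g)) ≡ (∑[ b < M ] u b) * Amul M n 0 v f
    ∑-A-⊗-zero {n} c f u v = begin
      ∑[ b < M ] ∑[ g ∈ Vs ] (1ℚ * (u b * v g))
        ≡⟨ sum-cong-≗ (λ b → ∑ˡ-cong Vs (λ g → x∙yz≈y∙xz 1ℚ (u b) (v g))) ⟩
      ∑[ b < M ] ∑[ g ∈ Vs ] (u b * (1ℚ * v g))
        ≡⟨ sum-cong-≗ (λ b → *-distribˡ-∑ˡ Vs (u b) (λ g → 1ℚ * v g)) ⟨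
      ∑[ b < M ] (u b * Amul M n 0 v f)
        ≡⟨ *-distribʳ-sum (Amul M n 0 v f) u ⟨
      (∑[ b < M ] u b) * Amul M n 0 v f  ∎
      where
      open ≡-Reasoning
      Vs = allVecs M n

    ∑-A-⊗-suc : ∀ {n} k (c : Fin M) (f : Vec (Fin M) n) (u : Fin M → ℚ) (v : Vec (Fin M) n → ℚ) →
      ∑[ b < M ] ∑[ g ∈ allVecs M n ] (A (suc k) (c ∷ f) (b ∷ g) * (u b * v g))
        ≡ (∑[ b < M ] u b) * Amul M n (suc k) v f + u c * Amul M n k v f
    ∑-A-⊗-suc {n} k c f u v = begin
      ∑[ b < M ] ∑[ g ∈ Vs ] (A (suc k) (c ∷ f) (b ∷ g) * (u b * v g))
        ≡⟨ sum-cong-≗ (λ b → ∑ˡ-cong Vs (λ g → trans (cong (_* (u b * v g)) (A-suc-∷ k b c f g))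
                                                     (distribute (A (suc k) f g) (δ b c) (A k f g) (u b) (v g)))) ⟩
      ∑[ b < M ] ∑[ g ∈ Vs ] (u b * (A (suc k) f g * v g) + (δ b c * u b) * (A k f g * v g))
        ≡⟨ sum-cong-≗ (λ b → trans (∑ˡ-distrib-+ Vs (λ g → u b * (A (suc k) f g * v g)) (λ g → (δ b c * u b) * (A k f g * v g)))
                                   (sym (cong₂ _+_ (*-distribˡ-∑ˡ Vs (u b) (λ g → A (suc k) f g * v g))
                                                   (*-distribˡ-∑ˡ Vs (δ b c * u b) (λ g → A k f g * v g))))) ⟩
      ∑[ b < M ] (u b * S₁ + (δ b c * u b) * S₀)
        ≡⟨ ∑-distrib-+ (λ b → u b * S₁) (λ b → (δ b c * u b) * S₀) ⟩
      ∑[ b < M ] (u b * S₁) + ∑[ b < M ] ((δ b c * u b) * S₀)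
        ≡⟨ sym (cong₂ _+_ (*-distribʳ-sum S₁ u) (*-distribʳ-sum S₀ (λ b → δ b c * u b))) ⟩
      (∑[ b < M ] u b) * S₁ + (∑[ b < M ] (δ b c * u b)) * S₀
        ≡⟨ cong (λ s → (∑[ b < M ] u b) * S₁ + s * S₀) (∑-δ c u) ⟩
      (∑[ b < M ] u b) * S₁ + u c * S₀  ∎
      where
      open ≡-Reasoning
      Vs = allVecs M n
      S₁ = Amul M n (suc k) v f
      S₀ = Amul M n k v f
      distribute : ∀ x d y p q → (x + d * y) * (p * q) ≡ p * (x * q) + (d * p) * (y * q)
      distribute = solve-∀ ℚ-ring

  module Eigenvectors (m' : ℕ) where

    open TensorBasis m' public

    private
      M = suc m'

    eigenvalue : ∀ {n} → ℕ → Vec (Fin M) n → ℕ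
    eigenvalue k       []          = 0 C k
    eigenvalue zero    (zero  ∷ x) = M ℕ.* eigenvalue zero x
    eigenvalue zero    (suc _ ∷ x) = 0
    eigenvalue (suc k) (zero  ∷ x) = M ℕ.* eigenvalue (suc k) x ℕ.+ eigenvalue k x
    eigenvalue (suc k) (suc _ ∷ x) = eigenvalue k x

    A-basis : ∀ {n} k (x f : Vec (Fin M) n) → Amul M n k (basis x) f ≡ ℕ→ℚ (eigenvalue k x) * basis x f
    A-basis k [] [] = +-identityʳ _
    A-basis {suc n} zero (a ∷ x) (c ∷ f) = begin
      Amul M (suc n) 0 (basis (a ∷ x)) (c ∷ f)
        ≡⟨ ∑ᵥ-∷ M n _ ⟩
      ∑[ b < M ] ∑[ g ∈ allVecs M n ] (A 0 (c ∷ f) (b ∷ g) * (basis₁ a b * basis x g))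
        ≡⟨ ∑-A-⊗-zero c f (basis₁ a) (basis x) ⟩
      (∑[ b < M ] basis₁ a b) * Amul M n 0 (basis x) f
        ≡⟨ cong₂ _*_ (∑-basis₁ a) (A-basis zero x f) ⟩
      (ℕ→ℚ M * δ zero a) * (ℕ→ℚ (eigenvalue 0 x) * basis x f)
        ≡⟨ step a ⟩
      ℕ→ℚ (eigenvalue 0 (a ∷ x)) * (basis₁ a c * basis x f)  ∎
      where
      open ≡-Reasoning
      step : ∀ a → (ℕ→ℚ M * δ zero a) * (ℕ→ℚ (eigenvalue 0 x) * basis x f)
                 ≡ ℕ→ℚ (eigenvalue 0 (a ∷ x)) * (basis₁ a c * basis x f)
      step zero    = trans (interchange (ℕ→ℚ M) 1ℚ (ℕ→ℚ (eigenvalue 0 x)) (basis x f))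
                           (cong (_* (1ℚ * basis x f)) (sym (ℕ→ℚ-* M (eigenvalue 0 x))))
      step (suc j) = begin
        (ℕ→ℚ M * 0ℚ) * (ℕ→ℚ (eigenvalue 0 x) * basis x f)
          ≡⟨ cong (_* (ℕ→ℚ (eigenvalue 0 x) * basis x f)) (*-zeroʳ (ℕ→ℚ M)) ⟩
        0ℚ * (ℕ→ℚ (eigenvalue 0 x) * basis x f)
          ≡⟨ *-zeroˡ (ℕ→ℚ (eigenvalue 0 x) * basis x f) ⟩
        0ℚ
          ≡⟨ *-zeroˡ (basis₁ (suc j) c * basis x f) ⟨
        0ℚ * (basis₁ (suc j) c * basis x f)  ∎
    A-basis {suc n} (suc k) (a ∷ x) (c ∷ f) = begin
      Amul M (suc n) (suc k) (basis (a ∷ x)) (c ∷ f)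
        ≡⟨ ∑ᵥ-∷ M n _ ⟩
      ∑[ b < M ] ∑[ g ∈ allVecs M n ] (A (suc k) (c ∷ f) (b ∷ g) * (basis₁ a b * basis x g))
        ≡⟨ ∑-A-⊗-suc k c f (basis₁ a) (basis x) ⟩
      (∑[ b < M ] basis₁ a b) * Amul M n (suc k) (basis x) f + basis₁ a c * Amul M n k (basis x) f
        ≡⟨ cong₂ (λ s t → s * Amul M n (suc k) (basis x) f + basis₁ a c * t) (∑-basis₁ a) (A-basis k x f) ⟩
      (ℕ→ℚ M * δ zero a) * Amul M n (suc k) (basis x) f + basis₁ a c * (λₖ * basis x f)
        ≡⟨ cong (λ t → (ℕ→ℚ M * δ zero a) * t + basis₁ a c * (λₖ * basis x f)) (A-basis (suc k) x f) ⟩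
      (ℕ→ℚ M * δ zero a) * (λₖ₊₁ * basis x f) + basis₁ a c * (λₖ * basis x f)
        ≡⟨ step a ⟩
      ℕ→ℚ (eigenvalue (suc k) (a ∷ x)) * (basis₁ a c * basis x f)  ∎
      where
      open ≡-Reasoning
      λₖ₊₁ = ℕ→ℚ (eigenvalue (suc k) x)
      λₖ   = ℕ→ℚ (eigenvalue k x)
      step : ∀ a → (ℕ→ℚ M * δ zero a) * (λₖ₊₁ * basis x f) + basis₁ a c * (λₖ * basis x f)
                 ≡ ℕ→ℚ (eigenvalue (suc k) (a ∷ x)) * (basis₁ a c * basis x f)
      step zero    = begin
        (ℕ→ℚ M * 1ℚ) * (λₖ₊₁ * basis x f) + 1ℚ * (λₖ * basis x f)
          ≡⟨ regroup (ℕ→ℚ M) 1ℚ λₖ₊₁ λₖ (basis x f) ⟩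
        (ℕ→ℚ M * λₖ₊₁ + λₖ) * (1ℚ * basis x f)
          ≡⟨ cong (λ e → (e + λₖ) * (1ℚ * basis x f)) (ℕ→ℚ-* M (eigenvalue (suc k) x)) ⟨
        (ℕ→ℚ (M ℕ.* eigenvalue (suc k) x) + λₖ) * (1ℚ * basis x f)
          ≡⟨ cong (_* (1ℚ * basis x f)) (ℕ→ℚ-+ (M ℕ.* eigenvalue (suc k) x) (eigenvalue k x)) ⟨
        ℕ→ℚ (eigenvalue (suc k) (zero ∷ x)) * (1ℚ * basis x f)  ∎
        where
        regroup : ∀ p o q r s → (p * o) * (q * s) + o * (r * s) ≡ (p * q + r) * (o * s)
        regroup = solve-∀ ℚ-ring
      step (suc j) = begin
        (ℕ→ℚ M * 0ℚ) * (λₖ₊₁ * basis x f) + e * (λₖ * basis x f)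
          ≡⟨ cong (_+ e * (λₖ * basis x f)) (trans (cong (_* (λₖ₊₁ * basis x f)) (*-zeroʳ (ℕ→ℚ M))) (*-zeroˡ (λₖ₊₁ * basis x f))) ⟩
        0ℚ + e * (λₖ * basis x f)
          ≡⟨ +-identityˡ (e * (λₖ * basis x f)) ⟩
        e * (λₖ * basis x f)
          ≡⟨ x∙yz≈y∙xz e λₖ (basis x f) ⟩
        λₖ * (e * basis x f)  ∎
        where e = basis₁ (suc j) c

  NontrivialRelation : ∀ {k d} → (Fin k → Fin d → ℚ) → Set
  NontrivialRelation {k} {d} u =
    Σ (Fin k → ℚ) λ c → (∀ j → ∑[ i < k ] (c i * u i j) ≡ 0ℚ) × ∃ λ i → c i ≢ 0ℚ

  ∑-insertAt : ∀ {n} (c : Fin n → ℚ) (p : Fin (suc n)) (cₚ : ℚ) (w : Fin (suc n) → ℚ) →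
    ∑[ x < suc n ] (insertAt c p cₚ x * w x) ≡ cₚ * w p + ∑[ i < n ] (c i * w (punchIn p i))
  ∑-insertAt c p cₚ w = trans (sum-remove {i = p} (λ x → insertAt c p cₚ x * w x))
    (cong₂ _+_ (cong (_* w p) (insertAt-lookup c p cₚ))
               (sum-cong-≗ (λ i → cong (_* w (punchIn p i)) (insertAt-punchIn c p cₚ i))))

  lift-relation : ∀ {d} (u : Fin (suc (suc d)) → Fin (suc d) → ℚ) (p : Fin (suc (suc d))) (r : Fin (suc d) → ℚ) →
    (∀ i → u (punchIn p i) zero ≡ r i * u p zero) →
    NontrivialRelation (λ i j → u (punchIn p i) (suc j) - r i * u p (suc j)) →
    NontrivialRelation u
  lift-relation {d} u p r ratio (c , c-rel , (i₀ , cᵢ₀≢0)) = c′ , c′-rel , (punchIn p i₀ , c′ᵢ₀≢0)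
    where
    cₚ = - ∑[ i < suc d ] (c i * r i)
    c′ = insertAt c p cₚ

    reduce : ∀ (w : Fin (suc (suc d)) → ℚ) →
             ∑[ x < suc (suc d) ] (c′ x * w x) ≡ ∑[ i < suc d ] (c i * (w (punchIn p i) - r i * w p))
    reduce w = begin
      ∑[ x < suc (suc d) ] (c′ x * w x)
        ≡⟨ ∑-insertAt c p cₚ w ⟩
      cₚ * w p + ∑[ i < suc d ] (c i * w (punchIn p i))
        ≡⟨ negate-first (∑[ i < suc d ] (c i * r i)) (w p) (∑[ i < suc d ] (c i * w (punchIn p i))) ⟩
      ∑[ i < suc d ] (c i * w (punchIn p i)) - (∑[ i < suc d ] (c i * r i)) * w p
        ≡⟨ cong (λ z → ∑[ i < suc d ] (c i * w (punchIn p i)) - z) (*-distribʳ-sum (w p) (λ i → c i * r i)) ⟩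
      ∑[ i < suc d ] (c i * w (punchIn p i)) - ∑[ i < suc d ] (c i * r i * w p)
        ≡⟨ ∑-distrib-- (suc d) (λ i → c i * w (punchIn p i)) (λ i → c i * r i * w p) ⟨
      ∑[ i < suc d ] (c i * w (punchIn p i) - c i * r i * w p)
        ≡⟨ sum-cong-≗ (λ i → factor (c i) (w (punchIn p i)) (r i) (w p)) ⟩
      ∑[ i < suc d ] (c i * (w (punchIn p i) - r i * w p))  ∎
      where
      open ≡-Reasoning
      negate-first : ∀ s x t → (- s) * x + t ≡ t - s * x
      negate-first = solve-∀ ℚ-ring
      factor : ∀ a b e f → a * b - a * e * f ≡ a * (b - e * f)
      factor = solve-∀ ℚ-ring

    c′-rel : ∀ j → ∑[ x < suc (suc d) ] (c′ x * u x j) ≡ 0ℚ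
    c′-rel zero    = trans (reduce (λ x → u x zero))
      (∑-zero (suc d) (λ i → trans (cong (λ t → c i * (t - r i * u p zero)) (ratio i))
                                   (trans (cong (c i *_) (+-inverseʳ (r i * u p zero))) (*-zeroʳ (c i)))))
    c′-rel (suc j) = trans (reduce (λ x → u x (suc j))) (c-rel j)

    c′ᵢ₀≢0 : c′ (punchIn p i₀) ≢ 0ℚ
    c′ᵢ₀≢0 = cᵢ₀≢0 ∘ trans (sym (insertAt-punchIn c p cₚ i₀))

  -- Eliminate the first coordinate using a pivot row p; if the first column vanishes, p = 0 with ratios 0 works.
  suc-vectors-dependent : ∀ d (u : Fin (suc d) → Fin d → ℚ) → NontrivialRelation u
  suc-vectors-dependent zero    u = (λ _ → 1ℚ) , (λ ()) , (zero , 1≢0)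
  suc-vectors-dependent (suc d) u with all? (λ i → u i zero ≟ 0ℚ)
  ... | yes column≡0 = lift-relation u zero (λ _ → 0ℚ) (λ i → trans (column≡0 (suc i)) (sym (*-zeroˡ (u zero zero))))
                         (suc-vectors-dependent d (λ i j → u (suc i) (suc j) - 0ℚ * u zero (suc j)))
  ... | no column≢0 = lift-relation u p r ratio (suc-vectors-dependent d (λ i j → u (punchIn p i) (suc j) - r i * u p (suc j)))
    where
    pivot = ¬∀⟶∃¬ _ (λ i → u i zero ≡ 0ℚ) (λ i → u i zero ≟ 0ℚ) column≢0
    p = proj₁ pivot
    instance
      pivot≢0 = ≢-nonZero (proj₂ pivot)
    r : Fin (suc d) → ℚ
    r i = u (punchIn p i) zero * 1/ u p zero
    ratio : ∀ i → u (punchIn p i) zero ≡ r i * u p zero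
    ratio i = sym (begin
      u (punchIn p i) zero * 1/ u p zero * u p zero
        ≡⟨ *-assoc (u (punchIn p i) zero) (1/ u p zero) (u p zero) ⟩
      u (punchIn p i) zero * (1/ u p zero * u p zero)
        ≡⟨ cong (u (punchIn p i) zero *_) (*-inverseˡ (u p zero)) ⟩
      u (punchIn p i) zero * 1ℚ
        ≡⟨ *-identityʳ _ ⟩
      u (punchIn p i) zero  ∎)
      where open ≡-Reasoning

  allVecs-complete : ∀ m n (x : Vec (Fin m) n) → x ∈ allVecs m n
  allVecs-complete m zero    []      = here refl
  allVecs-complete m (suc n) (a ∷ x) =
    ∈-concatMap⁺ (λ b → map (b ∷_) (allVecs m n))
                 (Any.map (λ { refl → ∈-map⁺ (a ∷_) (allVecs-complete m n x) }) (∈-allFin a))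

  allVecs-unique : ∀ m n → Unique (allVecs m n)
  allVecs-unique m zero    = All.[] ∷ []
  allVecs-unique m (suc n) = Unique.concat⁺ (All.map⁺ (All.tabulate (λ _ → blocks-unique)))
                                            (AllPairs.map⁺ (AllPairs.map blocks-disjoint (Unique.allFin⁺ m)))
    where
    blocks-unique : ∀ {a} → Unique (map (a ∷_) (allVecs m n))
    blocks-unique = Unique.map⁺ ∷-injectiveʳ (allVecs-unique m n)
    blocks-disjoint : ∀ {a b} → a ≢ b → Disjoint (map (a ∷_) (allVecs m n)) (map (b ∷_) (allVecs m n))
    blocks-disjoint {a} {b} a≢b (x∈a , x∈b) with ∈-map⁻ (a ∷_) x∈a | ∈-map⁻ (b ∷_) x∈b
    ... | _ , _ , refl | _ , _ , eq = a≢b (∷-injectiveˡ eq)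

  lookup-injective : ∀ {a} {X : Set a} {xs : List X} → Unique xs → ∀ i j → lookup xs i ≡ lookup xs j → i ≡ j
  lookup-injective (_  ∷ _) zero    zero    _  = refl
  lookup-injective (x∉ ∷ _) zero    (suc j) eq = contradiction eq (All.lookup x∉ (∈-lookup j))
  lookup-injective (x∉ ∷ _) (suc i) zero    eq = contradiction (sym eq) (All.lookup x∉ (∈-lookup i))
  lookup-injective (_  ∷ u) (suc i) (suc j) eq = cong suc (lookup-injective u i j eq)

  module Dimension (m' n : ℕ) where

    open TensorBasis m'

    private
      M = suc m'

    coord-lincomb : ∀ d (c : Fin d → ℚ) (vs : Fin d → QVec M n) y →
                    coord (lincomb d c vs) y ≡ ∑[ i ∈ allFin d ] (c i * coord (vs i) y)
    coord-lincomb d c vs y = ∑ˡ-linear (allVecs M n) (allFin d) (dual y) c vs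

    -- Such an S is the span of the basis vectors basis x with P x.
    record IsCoordinateSubspace (S : QVec M n → Set) {p} (P : Vec (Fin M) n → Set p) : Set p where
      field
        basis-∈   : ∀ x → P x → S (basis x)
        lincomb-∈ : ∀ d (c : Fin d → ℚ) (vs : Fin d → QVec M n) → (∀ i → S (vs i)) → S (lincomb d c vs)
        coord-∉   : ∀ v → S v → ∀ y → ¬ P y → coord v y ≡ 0ℚ

    module _ {S : QVec M n → Set} {p} {P : Vec (Fin M) n → Set p} (P? : Decidable P)
             (S-coordinate : IsCoordinateSubspace S P) where

      open IsCoordinateSubspace S-coordinate

      private
        selected = filter P? (allVecs M n)
        D = length selected
        e : Fin D → Vec (Fin M) n
        e = lookup selected

        e-selected : ∀ j → P (e j)
        e-selected j = proj₂ (∈-filter⁻ P? {xs = allVecs M n} (∈-lookup j))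

        e-injective : ∀ i j → e i ≡ e j → i ≡ j
        e-injective = lookup-injective (Unique.filter⁺ P? (allVecs-unique M n))

        e-surjective : ∀ y → P y → ∃ λ j → y ≡ e j
        e-surjective y Py = Any.index y∈selected , lookup-index y∈selected
          where y∈selected = ∈-filter⁺ P? (allVecs-complete M n y) Py

        coord-selected : ∀ i j → coord (basis (e i)) (e j) ≡ δ i j
        coord-selected i j with i Fin.≟ j
        ... | yes refl = trans (dual-basis (e i) (e i)) (trans (δⁿ-refl (e i)) (sym (δ-refl i)))
        ... | no i≢j   = trans (dual-basis (e j) (e i)) (trans (δⁿ-≢ (i≢j ∘ sym ∘ e-injective j i)) (sym (δ-≢ i≢j)))

      selected-basis-independent : LinIndep D (basis ∘ e)
      selected-basis-independent c combination≡0 j = begin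
        c j
          ≡⟨ ∑-δ j c ⟨
        ∑[ i < D ] (δ i j * c i)
          ≡⟨ sum-cong-≗ (λ i → trans (*-comm (δ i j) (c i)) (cong (c i *_) (sym (coord-selected i j)))) ⟩
        ∑[ i < D ] (c i * coord (basis (e i)) (e j))
          ≡⟨ ∑ˡ-allFin D (λ i → c i * coord (basis (e i)) (e j)) ⟨
        ∑[ i ∈ allFin D ] (c i * coord (basis (e i)) (e j))
          ≡⟨ coord-lincomb D c (basis ∘ e) (e j) ⟨
        coord (lincomb D c (basis ∘ e)) (e j)
          ≡⟨ ∑ˡ-zero (allVecs M n) (λ f → trans (cong (dual (e j) f *_) (combination≡0 f)) (*-zeroʳ (dual (e j) f))) ⟩
        0ℚ  ∎
        where open ≡-Reasoning

      coordinateSubspace-bounded : (vs : Fin (suc D) → QVec M n) → (∀ i → S (vs i)) → ¬ LinIndep (suc D) vs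
      coordinateSubspace-bounded vs vs∈S independent = cᵢ₀≢0 (independent c w≡0 i₀)
        where
        relation = suc-vectors-dependent D (λ i j → coord (vs i) (e j))
        c = proj₁ relation
        i₀ = proj₁ (proj₂ (proj₂ relation))
        cᵢ₀≢0 = proj₂ (proj₂ (proj₂ relation))
        w = lincomb (suc D) c vs
        coord-w : ∀ y → coord w y ≡ 0ℚ
        coord-w y with P? y
        ... | no ¬Py = coord-∉ w (lincomb-∈ (suc D) c vs vs∈S) y ¬Py
        ... | yes Py with e-surjective y Py
        ...   | j , refl = begin
          coord w (e j)
            ≡⟨ coord-lincomb (suc D) c vs (e j) ⟩
          ∑[ i ∈ allFin (suc D) ] (c i * coord (vs i) (e j))
            ≡⟨ ∑ˡ-allFin (suc D) (λ i → c i * coord (vs i) (e j)) ⟩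
          ∑[ i < suc D ] (c i * coord (vs i) (e j))
            ≡⟨ proj₁ (proj₂ relation) j ⟩
          0ℚ  ∎
          where open ≡-Reasoning
        w≡0 : ∀ f → w f ≡ 0ℚ
        w≡0 f = trans (sym (basis-expansion w f))
                      (∑ˡ-zero (allVecs M n) (λ y → trans (cong (_* basis y f) (coord-w y)) (*-zeroˡ (basis y f))))

      coordinateSubspace-hasDim : HasDim M n S D
      coordinateSubspace-hasDim = (basis ∘ e , (λ j → basis-∈ (e j) (e-selected j)) , selected-basis-independent)
                                , coordinateSubspace-bounded

  module Spaces (m' n k : ℕ) where

    open Eigenvectors m'
    open Dimension m' n

    private
      M = suc m'
      Vs = allVecs M n
      λ[_] : Vec (Fin M) n → ℚ
      λ[ x ] = ℕ→ℚ (eigenvalue k x)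

    Amul-cong : ∀ {v v′ : QVec M n} → (∀ g → v g ≡ v′ g) → ∀ f → Amul M n k v f ≡ Amul M n k v′ f
    Amul-cong v≡v′ f = ∑ˡ-cong Vs (λ g → cong (A k f g *_) (v≡v′ g))

    coord-cong : ∀ {v v′ : QVec M n} → (∀ g → v g ≡ v′ g) → ∀ y → coord v y ≡ coord v′ y
    coord-cong v≡v′ y = ∑ˡ-cong Vs (λ g → cong (dual y g *_) (v≡v′ g))

    Amul-linear : ∀ {b} {Y : Set b} (ys : List Y) (c : Y → ℚ) (w : Y → QVec M n) f →
                  Amul M n k (λ g → ∑[ y ∈ ys ] (c y * w y g)) f ≡ ∑[ y ∈ ys ] (c y * Amul M n k (w y) f)
    Amul-linear ys c w f = ∑ˡ-linear Vs ys (A k f) c w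

    Amul-expansion : ∀ (v : QVec M n) f → Amul M n k v f ≡ ∑[ x ∈ Vs ] ((coord v x * λ[ x ]) * basis x f)
    Amul-expansion v f = begin
      Amul M n k v f
        ≡⟨ Amul-cong (λ g → sym (basis-expansion v g)) f ⟩
      Amul M n k (λ g → ∑[ x ∈ Vs ] (coord v x * basis x g)) f
        ≡⟨ Amul-linear Vs (coord v) basis f ⟩
      ∑[ x ∈ Vs ] (coord v x * Amul M n k (basis x) f)
        ≡⟨ ∑ˡ-cong Vs (λ x → cong (coord v x *_) (A-basis k x f)) ⟩
      ∑[ x ∈ Vs ] (coord v x * (λ[ x ] * basis x f))
        ≡⟨ ∑ˡ-cong Vs (λ x → *-assoc (coord v x) λ[ x ] (basis x f)) ⟨
      ∑[ x ∈ Vs ] ((coord v x * λ[ x ]) * basis x f)  ∎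
      where open ≡-Reasoning

    coord-Amul : ∀ (v : QVec M n) y → coord (Amul M n k v) y ≡ λ[ y ] * coord v y
    coord-Amul v y = begin
      coord (Amul M n k v) y
        ≡⟨ coord-cong (Amul-expansion v) y ⟩
      coord (λ f → ∑[ x ∈ Vs ] ((coord v x * λ[ x ]) * basis x f)) y
        ≡⟨ ∑ˡ-linear Vs Vs (dual y) (λ x → coord v x * λ[ x ]) basis ⟩
      ∑[ x ∈ Vs ] ((coord v x * λ[ x ]) * coord (basis x) y)
        ≡⟨ ∑ˡ-cong Vs (λ x → trans (cong ((coord v x * λ[ x ]) *_) (trans (dual-basis y x) (δⁿ-sym y x)))
                                   (*-comm (coord v x * λ[ x ]) (δⁿ x y))) ⟩
      ∑[ x ∈ Vs ] (δⁿ x y * (coord v x * λ[ x ]))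
        ≡⟨ ∑-δⁿ y (λ x → coord v x * λ[ x ]) ⟩
      coord v y * λ[ y ]
        ≡⟨ *-comm (coord v y) λ[ y ] ⟩
      λ[ y ] * coord v y  ∎
      where open ≡-Reasoning

    eigenspace-coordinate : ∀ μ → IsCoordinateSubspace (Eigenspace M n k μ) (λ x → μ ≡ λ[ x ])
    eigenspace-coordinate μ = record
      { basis-∈   = λ x μ≡λ f → trans (A-basis k x f) (cong (_* basis x f) (sym μ≡λ))
      ; lincomb-∈ = λ d c vs Avs≡μvs f → begin
          Amul M n k (lincomb d c vs) f
            ≡⟨ Amul-linear (allFin d) c vs f ⟩
          ∑[ i ∈ allFin d ] (c i * Amul M n k (vs i) f)
            ≡⟨ ∑ˡ-cong (allFin d) (λ i → cong (c i *_) (Avs≡μvs i f)) ⟩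
          ∑[ i ∈ allFin d ] (c i * (μ * vs i f))
            ≡⟨ ∑ˡ-scale (allFin d) c μ (λ i → vs i f) ⟩
          μ * lincomb d c vs f  ∎
      ; coord-∉   = coord-∉
      }
      where
      open ≡-Reasoning
      coord-∉ : ∀ v → Eigenspace M n k μ v → ∀ y → ¬ μ ≡ λ[ y ] → coord v y ≡ 0ℚ
      coord-∉ v Av≡μv y μ≢λ = decidable-stable (coord v y ≟ 0ℚ) λ coord≢0 →
        μ≢λ (*-cancelʳ-≡ μ λ[ y ] (coord v y) {{≢-nonZero coord≢0}} μc≡λc)
        where
        μc≡λc : μ * coord v y ≡ λ[ y ] * coord v y
        μc≡λc = begin
          μ * coord v y                      ≡⟨ ∑ˡ-scale Vs (dual y) μ v ⟨
          coord (λ f → μ * v f) y            ≡⟨ coord-cong (λ f → sym (Av≡μv f)) y ⟩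
          coord (Amul M n k v) y             ≡⟨ coord-Amul v y ⟩
          λ[ y ] * coord v y                 ∎

    image-coordinate : IsCoordinateSubspace (Image M n k) (λ x → ¬ λ[ x ] ≡ 0ℚ)
    image-coordinate = record
      { basis-∈   = basis-∈
      ; lincomb-∈ = λ d c vs vs∈image → lincomb d c (λ i → proj₁ (vs∈image i)) , λ f → begin
          lincomb d c vs f
            ≡⟨ ∑ˡ-cong (allFin d) (λ i → cong (c i *_) (proj₂ (vs∈image i) f)) ⟩
          ∑[ i ∈ allFin d ] (c i * Amul M n k (proj₁ (vs∈image i)) f)
            ≡⟨ Amul-linear (allFin d) c (λ i → proj₁ (vs∈image i)) f ⟨
          Amul M n k (lincomb d c (λ i → proj₁ (vs∈image i))) f  ∎
      ; coord-∉   = λ { v (w , v≡Aw) y ¬λ≢0 → begin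
          coord v y                   ≡⟨ coord-cong v≡Aw y ⟩
          coord (Amul M n k w) y      ≡⟨ coord-Amul w y ⟩
          λ[ y ] * coord w y          ≡⟨ cong (_* coord w y) (decidable-stable (λ[ y ] ≟ 0ℚ) ¬λ≢0) ⟩
          0ℚ * coord w y              ≡⟨ *-zeroˡ (coord w y) ⟩
          0ℚ                          ∎ }
      }
      where
      open ≡-Reasoning
      basis-∈ : ∀ x → ¬ λ[ x ] ≡ 0ℚ → Image M n k (basis x)
      basis-∈ x λ≢0 = (λ g → 1/ λ[ x ] * basis x g) , λ f → sym (begin
        Amul M n k (λ g → 1/ λ[ x ] * basis x g) f    ≡⟨ ∑ˡ-scale Vs (A k f) (1/ λ[ x ]) (basis x) ⟩
        1/ λ[ x ] * Amul M n k (basis x) f            ≡⟨ cong (1/ λ[ x ] *_) (A-basis k x f) ⟩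
        1/ λ[ x ] * (λ[ x ] * basis x f)              ≡⟨ *-assoc (1/ λ[ x ]) λ[ x ] (basis x f) ⟨
        (1/ λ[ x ] * λ[ x ]) * basis x f              ≡⟨ cong (_* basis x f) (*-inverseˡ λ[ x ]) ⟩
        1ℚ * basis x f                                ≡⟨ *-identityˡ (basis x f) ⟩
        basis x f                                     ∎)
        where instance _ = ≢-nonZero λ≢0

    eigenspace-hasDim : ∀ μ → HasDim M n (Eigenspace M n k μ) (length (filter (λ x → μ ≟ λ[ x ]) Vs))
    eigenspace-hasDim μ = coordinateSubspace-hasDim (λ x → μ ≟ λ[ x ]) (eigenspace-coordinate μ)

    image-hasDim : HasDim M n (Image M n k) (length (filter (λ x → ¬? (λ[ x ] ≟ 0ℚ)) Vs))
    image-hasDim = coordinateSubspace-hasDim (λ x → ¬? (λ[ x ] ≟ 0ℚ)) image-coordinate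

-- Counting by the number of zero coordinates

module _ where

  open import Data.Nat as ℕ using (ℕ; zero; suc; _+_; _*_; _∸_; _^_; _<_; _≤_; _>_; z≤n; s≤s)
  import Data.Nat.Properties as ℕ
  open import Data.Nat.ListAction using (sum)
  open import Data.Nat.Combinatorics using (_C_; nCk+nC[k+1]≡[n+1]C[k+1]; nCk≡nC[n∸k])
  open import Data.Nat.Combinatorics.Specification using (k>n⇒nCk≡0)
  open import Data.Nat.Tactic.RingSolver using (solve-∀)
  open import Data.Bool using (if_then_else_)
  open import Data.Fin using (Fin; zero; suc)
  open import Data.Vec using (Vec; []; _∷_)
  open import Data.List using (List; []; _∷_; map; filter; length; applyUpTo; upTo; tabulate)
  open import Data.Rational using (ℚ; 0ℚ)
  open import Data.Rational.Properties using (_≟_)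
  open import Algebra.Properties.CommutativeSemigroup ℕ.+-commutativeSemigroup using () renaming (interchange to +-interchange)
  open import Algebra.Properties.CommutativeSemigroup ℕ.*-commutativeSemigroup using (x∙yz≈y∙xz)
  open import Relation.Binary.PropositionalEquality
  open import Relation.Nullary using (Dec; yes; no; ¬?)
  open import Relation.Nullary.Decidable using (⌊_⌋)
  open import Relation.Nullary.Negation using (contradiction)
  open import Relation.Unary using (Pred; Decidable)
  open import Function using (_∘_)

  open ListSum ℕ.+-*-commutativeSemiring

  𝒵-≤ : ∀ {m n} (x : Vec (Fin m) n) → 𝒵 x ≤ n
  𝒵-≤ []          = z≤n
  𝒵-≤ (zero  ∷ x) = s≤s (𝒵-≤ x)
  𝒵-≤ (suc _ ∷ x) = ℕ.m≤n⇒m≤1+n (𝒵-≤ x)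

  module ClosedForm (m' : ℕ) where

    open Eigenvectors m'

    private
      M = suc m'

    vanishing-term : ∀ {n} d (x : Vec (Fin M) n) → d + 0 ≡ n → M ^ suc d * (𝒵 x C suc d) ≡ 0
    vanishing-term d x d+0≡n = trans (cong (M ^ suc d *_) (k>n⇒nCk≡0 (s≤s 𝒵≤d))) (ℕ.*-zeroʳ (M ^ suc d))
      where
      𝒵≤d : 𝒵 x ≤ d
      𝒵≤d = subst (𝒵 x ≤_) (trans (sym d+0≡n) (ℕ.+-identityʳ d)) (𝒵-≤ x)

    eigenvalue-vanishes : ∀ {n} k (x : Vec (Fin M) n) → n < k → eigenvalue k x ≡ 0
    eigenvalue-vanishes (suc k) []          _         = refl
    eigenvalue-vanishes (suc k) (zero  ∷ x) (s≤s n<k) = begin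
      M * eigenvalue (suc k) x + eigenvalue k x
        ≡⟨ cong₂ (λ p q → M * p + q) (eigenvalue-vanishes (suc k) x (ℕ.m<n⇒m<1+n n<k)) (eigenvalue-vanishes k x n<k) ⟩
      M * 0 + 0
        ≡⟨ trans (ℕ.+-identityʳ (M * 0)) (ℕ.*-zeroʳ M) ⟩
      0  ∎
      where open ≡-Reasoning
    eigenvalue-vanishes (suc k) (suc _ ∷ x) (s≤s n<k) = eigenvalue-vanishes k x n<k

    pascal-scaled : ∀ d z → M * (M ^ d * (z C d)) + M ^ suc d * (z C suc d) ≡ M ^ suc d * (suc z C suc d)
    pascal-scaled d z = begin
      M * (M ^ d * (z C d)) + M ^ suc d * (z C suc d)
        ≡⟨ cong (_+ M ^ suc d * (z C suc d)) (ℕ.*-assoc M (M ^ d) (z C d)) ⟨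
      M ^ suc d * (z C d) + M ^ suc d * (z C suc d)
        ≡⟨ ℕ.*-distribˡ-+ (M ^ suc d) (z C d) (z C suc d) ⟨
      M ^ suc d * (z C d + z C suc d)
        ≡⟨ cong (M ^ suc d *_) (nCk+nC[k+1]≡[n+1]C[k+1] z d) ⟩
      M ^ suc d * (suc z C suc d)  ∎
      where open ≡-Reasoning

    eigenvalue-closed : ∀ {n} d k (x : Vec (Fin M) n) → d + k ≡ n → eigenvalue k x ≡ M ^ d * (𝒵 x C d)
    eigenvalue-closed zero    zero    []          refl  = refl
    eigenvalue-closed (suc d) zero    (zero  ∷ x) d+0≡n = begin
      M * eigenvalue 0 x
        ≡⟨ cong (M *_) (eigenvalue-closed d 0 x (ℕ.suc-injective d+0≡n)) ⟩
      M * (M ^ d * (𝒵 x C d))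
        ≡⟨ ℕ.+-identityʳ _ ⟨
      M * (M ^ d * (𝒵 x C d)) + 0
        ≡⟨ cong (M * (M ^ d * (𝒵 x C d)) +_) (vanishing-term d x (ℕ.suc-injective d+0≡n)) ⟨
      M * (M ^ d * (𝒵 x C d)) + M ^ suc d * (𝒵 x C suc d)
        ≡⟨ pascal-scaled d (𝒵 x) ⟩
      M ^ suc d * (suc (𝒵 x) C suc d)  ∎
      where open ≡-Reasoning
    eigenvalue-closed (suc d) zero    (suc _ ∷ x) d+0≡n = sym (vanishing-term d x (ℕ.suc-injective d+0≡n))
    eigenvalue-closed d       (suc k) (suc _ ∷ x) d+k≡n =
      eigenvalue-closed d k x (ℕ.suc-injective (trans (sym (ℕ.+-suc d k)) d+k≡n))
    eigenvalue-closed zero    (suc k) (zero  ∷ x) refl  = begin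
      M * eigenvalue (suc k) x + eigenvalue k x
        ≡⟨ cong₂ (λ p q → M * p + q) (eigenvalue-vanishes (suc k) x (ℕ.n<1+n k)) (eigenvalue-closed 0 k x refl) ⟩
      M * 0 + 1 * (𝒵 x C 0)
        ≡⟨ cong (_+ 1 * (𝒵 x C 0)) (ℕ.*-zeroʳ M) ⟩
      1 * (suc (𝒵 x) C 0)  ∎
      where open ≡-Reasoning
    eigenvalue-closed (suc d) (suc k) (zero  ∷ x) d+k≡n = begin
      M * eigenvalue (suc k) x + eigenvalue k x
        ≡⟨ cong₂ (λ p q → M * p + q) (eigenvalue-closed d (suc k) x (trans (ℕ.+-suc d k) d+k≡n′))
                                     (eigenvalue-closed (suc d) k x d+k≡n′) ⟩
      M * (M ^ d * (𝒵 x C d)) + M ^ suc d * (𝒵 x C suc d)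
        ≡⟨ pascal-scaled d (𝒵 x) ⟩
      M ^ suc d * (suc (𝒵 x) C suc d)  ∎
      where
      open ≡-Reasoning
      d+k≡n′ = ℕ.suc-injective (trans (sym (ℕ.+-suc (suc d) k)) d+k≡n)

  ∑< : ℕ → (ℕ → ℕ) → ℕ
  ∑< zero    f = 0
  ∑< (suc N) f = f 0 + ∑< N (f ∘ suc)

  sum-applyUpTo : ∀ (f : ℕ → ℕ) g N → sum (map f (applyUpTo g N)) ≡ ∑< N (f ∘ g)
  sum-applyUpTo f g zero    = refl
  sum-applyUpTo f g (suc N) = cong (f (g 0) +_) (sum-applyUpTo f (g ∘ suc) N)

  sum-upTo : ∀ (f : ℕ → ℕ) N → sum (map f (upTo N)) ≡ ∑< N f
  sum-upTo f = sum-applyUpTo f (λ t → t)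

  ∑<-cong : ∀ N {f g : ℕ → ℕ} → (∀ t → t < N → f t ≡ g t) → ∑< N f ≡ ∑< N g
  ∑<-cong zero    f≡g = refl
  ∑<-cong (suc N) f≡g = cong₂ _+_ (f≡g 0 (s≤s z≤n)) (∑<-cong N (λ t t<N → f≡g (suc t) (s≤s t<N)))

  ∑<-zero : ∀ N {f : ℕ → ℕ} → (∀ t → t < N → f t ≡ 0) → ∑< N f ≡ 0
  ∑<-zero zero    f≡0 = refl
  ∑<-zero (suc N) f≡0 = cong₂ _+_ (f≡0 0 (s≤s z≤n)) (∑<-zero N (λ t t<N → f≡0 (suc t) (s≤s t<N)))

  ∑<-distrib-+ : ∀ N (f g : ℕ → ℕ) → ∑< N (λ t → f t + g t) ≡ ∑< N f + ∑< N g
  ∑<-distrib-+ zero    f g = refl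
  ∑<-distrib-+ (suc N) f g = trans (cong (f 0 + g 0 +_) (∑<-distrib-+ N (f ∘ suc) (g ∘ suc)))
                                   (+-interchange (f 0) (g 0) (∑< N (f ∘ suc)) (∑< N (g ∘ suc)))

  *-distribˡ-∑< : ∀ N c (f : ℕ → ℕ) → c * ∑< N f ≡ ∑< N (λ t → c * f t)
  *-distribˡ-∑< zero    c f = ℕ.*-zeroʳ c
  *-distribˡ-∑< (suc N) c f = trans (ℕ.*-distribˡ-+ c (f 0) (∑< N (f ∘ suc))) (cong (c * f 0 +_) (*-distribˡ-∑< N c (f ∘ suc)))

  ∑<-split : ∀ a b (f : ℕ → ℕ) → ∑< (a + b) f ≡ ∑< a f + ∑< b (λ j → f (a + j))
  ∑<-split zero    b f = refl
  ∑<-split (suc a) b f = trans (cong (f 0 +_) (∑<-split a b (f ∘ suc))) (sym (ℕ.+-assoc (f 0) _ _))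

  ∑<-last : ∀ N (f : ℕ → ℕ) → ∑< (suc N) f ≡ ∑< N f + f N
  ∑<-last zero    f = ℕ.+-identityʳ (f 0)
  ∑<-last (suc N) f = trans (cong (f 0 +_) (∑<-last N (f ∘ suc))) (sym (ℕ.+-assoc (f 0) (∑< N (f ∘ suc)) (f (suc N))))

  ∑<-reverse : ∀ k (g : ℕ → ℕ) → ∑< (suc k) (λ j → g (k ∸ j)) ≡ ∑< (suc k) g
  ∑<-reverse zero    g = refl
  ∑<-reverse (suc k) g = begin
    g (suc k) + ∑< (suc k) (λ j → g (k ∸ j))   ≡⟨ cong (g (suc k) +_) (∑<-reverse k g) ⟩
    g (suc k) + ∑< (suc k) g                   ≡⟨ ℕ.+-comm (g (suc k)) (∑< (suc k) g) ⟩
    ∑< (suc k) g + g (suc k)                   ≡⟨ ∑<-last (suc k) g ⟨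
    ∑< (suc (suc k)) g                         ∎
    where open ≡-Reasoning

  length-filter≡∑ : ∀ {a p} {X : Set a} {P : Pred X p} (P? : Decidable P) (xs : List X) →
                    length (filter P? xs) ≡ ∑ˡ xs (λ x → if ⌊ P? x ⌋ then 1 else 0)
  length-filter≡∑ P? []       = refl
  length-filter≡∑ P? (x ∷ xs) with P? x
  ... | yes _ = cong suc (length-filter≡∑ P? xs)
  ... | no  _ = length-filter≡∑ P? xs

  ∑ˡ-tabulate-const : ∀ {a} {X : Set a} N (g : Fin N → X) (f : X → ℕ) c → (∀ i → f (g i) ≡ c) →
                      ∑ˡ (tabulate g) f ≡ N * c
  ∑ˡ-tabulate-const zero    g f c fg≡c = refl
  ∑ˡ-tabulate-const (suc N) g f c fg≡c = cong₂ _+_ (fg≡c zero) (∑ˡ-tabulate-const N (g ∘ suc) f c (fg≡c ∘ suc))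

  module Counting (m' : ℕ) where

    private
      M = suc m'

    term-zero : ∀ n → term M (suc n) 0 ≡ m' * term M n 0
    term-zero n = trans (ℕ.*-identityˡ (m' * m' ^ n)) (cong (m' *_) (sym (ℕ.*-identityˡ (m' ^ n))))

    term-suc : ∀ n t → term M (suc n) (suc t) ≡ term M n t + m' * term M n (suc t)
    term-suc n t = begin
      (suc n C suc t) * m' ^ (n ∸ t)
        ≡⟨ cong (_* m' ^ (n ∸ t)) (nCk+nC[k+1]≡[n+1]C[k+1] n t) ⟨
      (n C t + n C suc t) * m' ^ (n ∸ t)
        ≡⟨ ℕ.*-distribʳ-+ (m' ^ (n ∸ t)) (n C t) (n C suc t) ⟩
      term M n t + (n C suc t) * m' ^ (n ∸ t)
        ≡⟨ cong (term M n t +_) (shift (t ℕ.<? n)) ⟩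
      term M n t + m' * term M n (suc t)  ∎
      where
      open ≡-Reasoning
      shift : Dec (t < n) → (n C suc t) * m' ^ (n ∸ t) ≡ m' * ((n C suc t) * m' ^ (n ∸ suc t))
      shift (yes t<n) = trans (cong (λ e → (n C suc t) * m' ^ e) (ℕ.+-∸-assoc 1 t<n))
                              (x∙yz≈y∙xz (n C suc t) m' (m' ^ (n ∸ suc t)))
      shift (no  t≮n) rewrite k>n⇒nCk≡0 (s≤s (ℕ.≮⇒≥ t≮n)) = sym (ℕ.*-zeroʳ m')

    ∑-𝒵 : ∀ n (h : ℕ → ℕ) → ∑ˡ (allVecs M n) (h ∘ 𝒵) ≡ ∑< (suc n) (λ t → h t * term M n t)
    ∑-𝒵 zero    h = cong (_+ 0) (sym (ℕ.*-identityʳ (h 0)))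
    ∑-𝒵 (suc n) h = begin
      ∑ˡ (allVecs M (suc n)) (h ∘ 𝒵)
        ≡⟨ ∑ˡ-allVecs-∷ M n (h ∘ 𝒵) ⟩
      ∑ˡ (allVecs M n) (h ∘ suc ∘ 𝒵) + ∑[ a ∈ tabulate {n = m'} suc ] ∑ˡ (allVecs M n) (λ x → h (𝒵 (a ∷ x)))
        ≡⟨ cong₂ _+_ (∑-𝒵 n (h ∘ suc)) (∑ˡ-tabulate-const m' suc _ _ (λ _ → refl)) ⟩
      ∑< (suc n) G + m' * ∑ˡ (allVecs M n) (h ∘ 𝒵)
        ≡⟨ cong (λ s → ∑< (suc n) G + m' * s) (trans (∑-𝒵 n h) F-extend) ⟩
      ∑< (suc n) G + m' * (F 0 + ∑< (suc n) (F ∘ suc))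
        ≡⟨ regroup (∑< (suc n) G) m' (h 0) (term M n 0) (∑< (suc n) (F ∘ suc)) ⟩
      h 0 * (m' * term M n 0) + (∑< (suc n) G + m' * ∑< (suc n) (F ∘ suc))
        ≡⟨ cong₂ _+_ (cong (h 0 *_) (sym (term-zero n)))
                     (trans (cong (∑< (suc n) G +_) (*-distribˡ-∑< (suc n) m' (F ∘ suc)))
                            (sym (∑<-distrib-+ (suc n) G (λ t → m' * F (suc t))))) ⟩
      h 0 * term M (suc n) 0 + ∑< (suc n) (λ t → G t + m' * F (suc t))
        ≡⟨ cong (h 0 * term M (suc n) 0 +_) (∑<-cong (suc n) (λ t _ → recombine t)) ⟩
      h 0 * term M (suc n) 0 + ∑< (suc n) (λ t → h (suc t) * term M (suc n) (suc t))  ∎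
      where
      open ≡-Reasoning
      F G : ℕ → ℕ
      F t = h t * term M n t
      G t = h (suc t) * term M n t
      F-extend : ∑< (suc n) F ≡ ∑< (suc (suc n)) F
      F-extend = sym (begin
        ∑< (suc (suc n)) F                                    ≡⟨ ∑<-last (suc n) F ⟩
        ∑< (suc n) F + h (suc n) * term M n (suc n)           ≡⟨ cong (λ c → ∑< (suc n) F + h (suc n) * (c * m' ^ (n ∸ suc n)))
                                                                        (k>n⇒nCk≡0 (ℕ.n<1+n n)) ⟩
        ∑< (suc n) F + h (suc n) * 0
          ≡⟨ cong (∑< (suc n) F +_) (ℕ.*-zeroʳ (h (suc n))) ⟩
        ∑< (suc n) F + 0
          ≡⟨ ℕ.+-identityʳ (∑< (suc n) F) ⟩
        ∑< (suc n) F  ∎)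
      regroup : ∀ g m h₀ t₀ r → g + m * (h₀ * t₀ + r) ≡ h₀ * (m * t₀) + (g + m * r)
      regroup = solve-∀
      recombine : ∀ t → G t + m' * F (suc t) ≡ h (suc t) * term M (suc n) (suc t)
      recombine t = begin
        h (suc t) * term M n t + m' * (h (suc t) * term M n (suc t))
          ≡⟨ cong (h (suc t) * term M n t +_) (x∙yz≈y∙xz m' (h (suc t)) (term M n (suc t))) ⟩
        h (suc t) * term M n t + h (suc t) * (m' * term M n (suc t))
          ≡⟨ ℕ.*-distribˡ-+ (h (suc t)) (term M n t) (m' * term M n (suc t)) ⟨
        h (suc t) * (term M n t + m' * term M n (suc t))
          ≡⟨ cong (h (suc t) *_) (term-suc n t) ⟨
        h (suc t) * term M (suc n) (suc t)  ∎

  nCk>0 : ∀ n k → k ≤ n → n C k > 0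
  nCk>0 n       zero    _         = s≤s z≤n
  nCk>0 (suc n) (suc k) (s≤s k≤n) =
    subst (0 <_) (nCk+nC[k+1]≡[n+1]C[k+1] n k) (ℕ.≤-trans (nCk>0 n k k≤n) (ℕ.m≤m+n (n C k) (n C suc k)))

  ind-1 : ∀ μ ν c → ind μ ν 1 * c ≡ ind μ ν c
  ind-1 μ ν c with μ ≟ ν
  ... | yes _ = ℕ.+-identityʳ c
  ... | no  _ = refl

  ind-≢ : ∀ {μ ν} c → μ ≢ ν → ind μ ν c ≡ 0
  ind-≢ {μ} {ν} c μ≢ν with μ ≟ ν
  ... | yes μ≡ν = contradiction μ≡ν μ≢ν
  ... | no  _   = refl

  nonzero : ℚ → ℕ
  nonzero q = if ⌊ ¬? (q ≟ 0ℚ) ⌋ then 1 else 0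

  nonzero-≢0 : ∀ {q} → q ≢ 0ℚ → nonzero q ≡ 1
  nonzero-≢0 {q} q≢0 with q ≟ 0ℚ
  ... | yes q≡0 = contradiction q≡0 q≢0
  ... | no  _   = refl

  module Multiplicities (m' n k : ℕ) (k≤n : k ≤ n) where

    open ClosedForm m'
    open Eigenvectors m' using (eigenvalue)
    open Counting m'

    private
      M = suc m'
      Vs = allVecs M n
      r = n ∸ k

    -- The eigenvalue of the basis vectors with t zero coordinates.
    Λ : ℕ → ℕ
    Λ t = M ^ r * (t C r)

    Λ-vanishes : ∀ t → t < r → Λ t ≡ 0
    Λ-vanishes t t<r = trans (cong (M ^ r *_) (k>n⇒nCk≡0 t<r)) (ℕ.*-zeroʳ (M ^ r))

    ℕ→ℚ-Λ≢0 : ∀ j → ℕ→ℚ (Λ (r + j)) ≢ 0ℚ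
    ℕ→ℚ-Λ≢0 j = ℕ→ℚ-≢0 (Λ (r + j)) {{ℕ.m*n≢0 (M ^ r) ((r + j) C r)}}
      where instance
        _ = ℕ.m^n≢0 M r
        _ = ℕ.>-nonZero (nCk>0 (r + j) r (ℕ.m≤m+n r j))

    ∑-eigenvalue : ∀ (h : ℕ → ℕ) → ∑ˡ Vs (λ x → h (eigenvalue k x))
                   ≡ h 0 * sum-kernel M n k + ∑< (suc k) (λ j → h (Λ (r + j)) * term M n (r + j))
    ∑-eigenvalue h = begin
      ∑ˡ Vs (λ x → h (eigenvalue k x))
        ≡⟨ ∑ˡ-cong Vs (λ x → cong h (eigenvalue-closed r k x (ℕ.m∸n+n≡m k≤n))) ⟩
      ∑ˡ Vs (λ x → h (Λ (𝒵 x)))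
        ≡⟨ ∑-𝒵 n (λ t → h (Λ t)) ⟩
      ∑< (suc n) (λ t → h (Λ t) * term M n t)
        ≡⟨ cong (λ N → ∑< N (λ t → h (Λ t) * term M n t)) suc-n≡r+suc-k ⟩
      ∑< (r + suc k) (λ t → h (Λ t) * term M n t)
        ≡⟨ ∑<-split r (suc k) (λ t → h (Λ t) * term M n t) ⟩
      ∑< r (λ t → h (Λ t) * term M n t) + ∑< (suc k) (λ j → h (Λ (r + j)) * term M n (r + j))
        ≡⟨ cong (_+ ∑< (suc k) (λ j → h (Λ (r + j)) * term M n (r + j))) kernel-part ⟩
      h 0 * sum-kernel M n k + ∑< (suc k) (λ j → h (Λ (r + j)) * term M n (r + j))  ∎
      where
      open ≡-Reasoning
      suc-n≡r+suc-k : suc n ≡ r + suc k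
      suc-n≡r+suc-k = trans (cong suc (sym (ℕ.m∸n+n≡m k≤n))) (sym (ℕ.+-suc r k))
      kernel-part : ∑< r (λ t → h (Λ t) * term M n t) ≡ h 0 * sum-kernel M n k
      kernel-part = begin
        ∑< r (λ t → h (Λ t) * term M n t)
          ≡⟨ ∑<-cong r (λ t t<r → cong (λ v → h v * term M n t) (Λ-vanishes t t<r)) ⟩
        ∑< r (λ t → h 0 * term M n t)
          ≡⟨ *-distribˡ-∑< r (h 0) (term M n) ⟨
        h 0 * ∑< r (term M n)
          ≡⟨ cong (h 0 *_) (sum-upTo (term M n) r) ⟨
        h 0 * sum-kernel M n k  ∎

    eigenspace-count : ∀ μ → length (filter (λ x → μ ≟ ℕ→ℚ (eigenvalue k x)) Vs) ≡ eigMult M n k μ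
    eigenspace-count μ = begin
      length (filter (λ x → μ ≟ ℕ→ℚ (eigenvalue k x)) Vs)
        ≡⟨ length-filter≡∑ (λ x → μ ≟ ℕ→ℚ (eigenvalue k x)) Vs ⟩
      ∑ˡ Vs (λ x → ind μ (ℕ→ℚ (eigenvalue k x)) 1)
        ≡⟨ ∑-eigenvalue (λ v → ind μ (ℕ→ℚ v) 1) ⟩
      ind μ 0ℚ 1 * sum-kernel M n k + ∑< (suc k) (λ j → ind μ (ℕ→ℚ (Λ (r + j))) 1 * term M n (r + j))
        ≡⟨ cong₂ _+_ (ind-1 μ 0ℚ (sum-kernel M n k))
                     (trans (∑<-cong (suc k) (λ j _ → ind-1 μ (ℕ→ℚ (Λ (r + j))) (term M n (r + j))))
                            (sym (sum-upTo _ (suc k)))) ⟩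
      eigMult M n k μ  ∎
      where open ≡-Reasoning

    kernel-multiplicity : eigMult M n k 0ℚ ≡ sum-kernel M n k
    kernel-multiplicity = begin
      sum-kernel M n k + sum (map (λ j → ind 0ℚ (ℕ→ℚ (Λ (r + j))) (term M n (r + j))) (upTo (suc k)))
        ≡⟨ cong (sum-kernel M n k +_) (trans (sum-upTo _ (suc k))
                                             (∑<-zero (suc k) (λ j _ → ind-≢ (term M n (r + j)) (ℕ→ℚ-Λ≢0 j ∘ sym)))) ⟩
      sum-kernel M n k + 0
        ≡⟨ ℕ.+-identityʳ (sum-kernel M n k) ⟩
      sum-kernel M n k  ∎
      where open ≡-Reasoning

    image-count : length (filter (λ x → ¬? (ℕ→ℚ (eigenvalue k x) ≟ 0ℚ)) Vs) ≡ rankFormula M n k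
    image-count = begin
      length (filter (λ x → ¬? (ℕ→ℚ (eigenvalue k x) ≟ 0ℚ)) Vs)
        ≡⟨ length-filter≡∑ (λ x → ¬? (ℕ→ℚ (eigenvalue k x) ≟ 0ℚ)) Vs ⟩
      ∑ˡ Vs (λ x → nonzero (ℕ→ℚ (eigenvalue k x)))
        ≡⟨ ∑-eigenvalue (nonzero ∘ ℕ→ℚ) ⟩
      0 * sum-kernel M n k + ∑< (suc k) (λ j → nonzero (ℕ→ℚ (Λ (r + j))) * term M n (r + j))
        ≡⟨ ∑<-cong (suc k) (λ j j≤k → trans (cong (_* term M n (r + j)) (nonzero-≢0 (ℕ→ℚ-Λ≢0 j)))
                                             (trans (ℕ.*-identityˡ (term M n (r + j))) (term-reflect j j≤k))) ⟩
      ∑< (suc k) (λ j → (n C (k ∸ j)) * m' ^ (k ∸ j))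
        ≡⟨ ∑<-reverse k (λ s → (n C s) * m' ^ s) ⟩
      ∑< (suc k) (λ s → (n C s) * m' ^ s)
        ≡⟨ sum-upTo (λ s → (n C s) * m' ^ s) (suc k) ⟨
      rankFormula M n k  ∎
      where
      open ≡-Reasoning
      term-reflect : ∀ j → j < suc k → term M n (r + j) ≡ (n C (k ∸ j)) * m' ^ (k ∸ j)
      term-reflect j (s≤s j≤k) = begin
        (n C (r + j)) * m' ^ (n ∸ (r + j))       ≡⟨ cong (_* m' ^ (n ∸ (r + j))) (nCk≡nC[n∸k] r+j≤n) ⟩
        (n C (n ∸ (r + j))) * m' ^ (n ∸ (r + j)) ≡⟨ cong (λ e → (n C e) * m' ^ e) n∸[r+j]≡k∸j ⟩
        (n C (k ∸ j)) * m' ^ (k ∸ j)             ∎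
        where
        r+j≤n : r + j ≤ n
        r+j≤n = ℕ.≤-trans (ℕ.+-monoʳ-≤ r j≤k) (ℕ.≤-reflexive (ℕ.m∸n+n≡m k≤n))
        n∸[r+j]≡k∸j : n ∸ (r + j) ≡ k ∸ j
        n∸[r+j]≡k∸j = trans (cong (_∸ (r + j)) (sym (ℕ.m∸n+n≡m k≤n))) (ℕ.[m+n]∸[m+o]≡n∸o r k j)

corollary4p9 : (m n k : ℕ) → 1 ≤ m → 1 ≤ n → k ≤ n →
    ((μ : ℚ) → HasDim m n (Eigenspace m n k μ) (eigMult m n k μ))
    × HasDim m n (Eigenspace m n k 0ℚ) (sum-kernel m n k)
    × HasDim m n (Image m n k) (rankFormula m n k)
corollary4p9 zero     _ _ () _ _
corollary4p9 (suc m') n k _  _ k≤n =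
    (λ μ → ≡.subst (HasDim M n (Eigenspace M n k μ)) (eigenspace-count μ) (eigenspace-hasDim μ))
  , ≡.subst (HasDim M n (Eigenspace M n k 0ℚ)) kernel-count (eigenspace-hasDim 0ℚ)
  , ≡.subst (HasDim M n (Image M n k)) image-count image-hasDim
  where
  M = suc m'
  open Spaces m' n k
  open Multiplicities m' n k k≤n
  kernel-count = ≡.trans (eigenspace-count 0ℚ) kernel-multiplicity
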